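{- Let $k$ be a natural number and let $\varphi$ be a formula of $\mathsf{HA}$ (possibly containing free variables). (1) If $\varphi \in \mathrm{E}_k^+$, then there exists $\varphi' \in \Sigma_k$ with $\mathrm{FV}(\varphi)=\mathrm{FV}(\varphi')$ and $\mathsf{HA} + \mathrm{DNE}(\Sigma_k) + \mathrm{DNS}(\mathrm{U}_k^+) \vdash \varphi \leftrightarrow \varphi'$. (2) If $\varphi \in \mathrm{U}_k^+$, then there exists $\varphi' \in \Pi_k$ with $\mathrm{FV}(\varphi)=\mathrm{FV}(\varphi')$ and $\mathsf{HA} + \mathrm{DNE}(\Pi_k \lor \Pi_k) \vdash \varphi \leftrightarrow \varphi'$.
   Context: $\mathsf{HA}$ is intuitionistic (Heyting) arithmetic in the language with function symbols for all primitive recursive functions and logical constants $\forall,\exists,\to,\land,\lor,\perp$; $\neg\varphi$ abbreviates $\varphi\to\perp$. For a theory $T$ and a schema $\mathrm{P}$, $T+\mathrm{P}$ is $T$ with all instances of $\mathrm{P}$ added as axioms, and $T\vdash \mathrm{P}$ means every instance of $\mathrm{P}$ is provable in $T$. $\mathrm{FV}(\varphi)$ is the set of free variables of $\varphi$. Arithmetical classes: $\Sigma_0=\Pi_0$ is the class of quantifier-free formulas; $\Pi_{k+1}$ consists of formulas $Q_1\bar x_1\cdots Q_{k+1}\bar x_{k+1}\,\varphi_{qf}$ with $\varphi_{qf}$ quantifier-free, $Q_i=\forall$ for odd $i$ and $\exists$ for even $i$; $\Sigma_{k+1}$ likewise with $Q_i=\exists$ for odd $i$ and $\forall$ for even $i$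 (blocks of like quantifiers; by the convention of the paper blocks may be empty, so $\Sigma_k\cup\Pi_k\subseteq\Sigma_{k'}\cap\Pi_{k'}$ for $k<k'$). For a class $\Gamma$, $\Gamma(\bar x)$ is the set of formulas in $\Gamma$ whose free variables are among $\bar x$. Principles: $\mathrm{DNE}(\Gamma)$: $\forall x(\neg\neg\varphi(x)\to\varphi(x))$ for $\varphi(x)\in\Gamma(x)$; $\mathrm{DNE}(\Gamma\lor\Gamma')$: $\forall x(\neg\neg(\varphi(x)\lor\psi(x))\to\varphi(x)\lor\psi(x))$ for $\varphi(x)\in\Gamma(x)$, $\psi(x)\in\Gamma'(x)$; $\mathrm{DNS}(\Gamma)$: $\forall x(\forall y\neg\neg\varphi(x,y)\to\neg\neg\forall y\varphi(x,y))$ for $\varphi(x,y)\in\Gamma(x,y)$. Alternation paths: finite sequences of $+$ and $-$ in which $+$ and $-$ alternate. For such $s$, $i(s)$ is its first symbol ($\times$ if $s$ is empty), $s^\perp$ swaps $+$ and $-$, and $l(s)$ is the length. The set $\mathrm{Alt}(\varphi)$: if $\varphi$ is quantifier-free, $\mathrm{Alt}(\varphi)=\{\langle\rangle\}$; otherwise inductively: $\mathrm{Alt}(\neg\varphi_1)=\{s^\perp: s\in\mathrm{Alt}(\varphi_1)\}$; $\mathrm{Alt}(\varphi_1\land\varphi_2)=\mathrm{Alt}(\varphi_1\lor\varphi_2)=\mathrm{Alt}(\varphi_1)\cup\mathrm{Alt}(\varphi_2)$; $\mathrm{Alt}(\varphi_1\to\varphi_2)=\{s^\perp:s\in\mathrm{Alt}(\varphi_1)\}\cup\mathrm{Alt}(\varphi_2)$;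 $\mathrm{Alt}(\forall x\varphi_1)=\{s\in\mathrm{Alt}(\varphi_1): i(s)=-\}\cup\{ -s: s\in\mathrm{Alt}(\varphi_1), i(s)\neq -\}$; $\mathrm{Alt}(\exists x\varphi_1)=\{s\in\mathrm{Alt}(\varphi_1): i(s)=+\}\cup\{+s: s\in\mathrm{Alt}(\varphi_1), i(s)\neq +\}$. The degree is $\deg(\varphi)=\max\{l(s):s\in\mathrm{Alt}(\varphi)\}$. Classes: $\mathrm{F}_k=\{\varphi:\deg(\varphi)=k\}$; $\mathrm{U}_0=\mathrm{E}_0=\mathrm{F}_0$; $\mathrm{U}_{k+1}=\{\varphi\in\mathrm{F}_{k+1}: i(s)=-\text{ for all } s\in\mathrm{Alt}(\varphi)\text{ with } l(s)=k+1\}$; $\mathrm{E}_{k+1}$ likewise with $i(s)=+$; $\mathrm{U}_k^+=\mathrm{U}_k\cup\bigcup_{i<k}\mathrm{F}_i$; $\mathrm{E}_k^+=\mathrm{E}_k\cup\bigcup_{i<k}\mathrm{F}_i$. -}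

module Defs where

open import Data.Nat using (ℕ; zero; suc; _<_; _⊔_)
open import Data.Fin using (Fin)
open import Data.Vec using (Vec; []; _∷_; lookup)
open import Data.Vec.Relation.Unary.Any using (Any)
open import Data.List using (List; []; _∷_; _++_; map; foldr; length)
open import Data.List.Relation.Unary.All using (All)
open import Data.List.Membership.Propositional using (_∈_)
open import Data.Maybe using (Maybe; just; nothing)
open import Data.Product using (Σ; _×_; _,_)
open import Data.Sum using (_⊎_)
open import Relation.Binary.PropositionalEquality using (_≡_)

-- Codes for primitive recursive functions (the function symbols of HA)
-- prec g h denotes R with R(0,xs) = g(xs), R(y+1,xs) = h(y, R(y,xs), xs).

data PR : ℕ → Set where
  zeroF : PR 0
  succF : PR 1
  proj  : ∀ {n} → Fin n → PR n
  comp  : ∀ {n m} → PR m → Vec (PR n) m → PR n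
  prec  : ∀ {n} → PR n → PR (suc (suc n)) → PR (suc n)

-- Terms and formulas (de Bruijn indices for variables)

data Term : Set where
  var : ℕ → Term
  app : ∀ {n} → PR n → Vec Term n → Term

infix  7 _≐_
infixr 6 _∧'_
infixr 5 _∨'_
infixr 4 _⇒_

data Formula : Set where
  _≐_  : Term → Term → Formula
  ⊥'   : Formula
  _⇒_  : Formula → Formula → Formula
  _∧'_ : Formula → Formula → Formula
  _∨'_ : Formula → Formula → Formula
  ∀'   : Formula → Formula
  ∃'   : Formula → Formula

¬' : Formula → Formula
¬' φ = φ ⇒ ⊥'

_⇔'_ : Formula → Formula → Formula
φ ⇔' ψ = (φ ⇒ ψ) ∧' (ψ ⇒ φ)

zeroT : Term
zeroT = app zeroF []

succT : Term → Term
succT t = app succF (t ∷ [])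

∀^ : ℕ → Formula → Formula
∀^ zero    φ = φ
∀^ (suc n) φ = ∀' (∀^ n φ)

mutual
  substT : (ℕ → Term) → Term → Term
  substT σ (var x)    = σ x
  substT σ (app f ts) = app f (substTs σ ts)

  substTs : ∀ {n} → (ℕ → Term) → Vec Term n → Vec Term n
  substTs σ []       = []
  substTs σ (t ∷ ts) = substT σ t ∷ substTs σ ts

shiftT : Term → Term
shiftT = substT (λ x → var (suc x))

lift : (ℕ → Term) → (ℕ → Term)
lift σ zero    = var zero
lift σ (suc x) = shiftT (σ x)

subst : (ℕ → Term) → Formula → Formula
subst σ (t ≐ s)  = substT σ t ≐ substT σ s
subst σ ⊥'       = ⊥'
subst σ (φ ⇒ ψ)  = subst σ φ ⇒ subst σ ψ
subst σ (φ ∧' ψ) = subst σ φ ∧' subst σ ψ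
subst σ (φ ∨' ψ) = subst σ φ ∨' subst σ ψ
subst σ (∀' φ)   = ∀' (subst (lift σ) φ)
subst σ (∃' φ)   = ∃' (subst (lift σ) φ)

shift : Formula → Formula
shift = subst (λ x → var (suc x))

sub0 : Term → (ℕ → Term)
sub0 t zero    = t
sub0 t (suc x) = var x

_[_] : Formula → Term → Formula
φ [ t ] = subst (sub0 t) φ

-- φ(S x) inside the binder of x
succSub : ℕ → Term
succSub zero    = succT (var zero)
succSub (suc x) = var (suc x)

mutual
  data FreeT (x : ℕ) : Term → Set where
    fvar : FreeT x (var x)
    fapp : ∀ {n} {f : PR n} {ts : Vec Term n} → FreeTs x ts → FreeT x (app f ts)

  data FreeTs (x : ℕ) : ∀ {n} → Vec Term n → Set where
    fhere  : ∀ {n} {t} {ts : Vec Term n} → FreeT x t → FreeTs x (t ∷ ts)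
    fthere : ∀ {n} {t} {ts : Vec Term n} → FreeTs x ts → FreeTs x (t ∷ ts)

data Free (x : ℕ) : Formula → Set where
  eqˡ  : ∀ {t s} → FreeT x t → Free x (t ≐ s)
  eqʳ  : ∀ {t s} → FreeT x s → Free x (t ≐ s)
  impˡ : ∀ {φ ψ} → Free x φ → Free x (φ ⇒ ψ)
  impʳ : ∀ {φ ψ} → Free x ψ → Free x (φ ⇒ ψ)
  andˡ : ∀ {φ ψ} → Free x φ → Free x (φ ∧' ψ)
  andʳ : ∀ {φ ψ} → Free x ψ → Free x (φ ∧' ψ)
  orˡ  : ∀ {φ ψ} → Free x φ → Free x (φ ∨' ψ)
  orʳ  : ∀ {φ ψ} → Free x ψ → Free x (φ ∨' ψ)
  all  : ∀ {φ} → Free (suc x) φ → Free x (∀' φ)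
  ex   : ∀ {φ} → Free (suc x) φ → Free x (∃' φ)

SameFV : Formula → Formula → Set
SameFV φ ψ = ∀ x → (Free x φ → Free x ψ) × (Free x ψ → Free x φ)

FVAmong : ℕ → Formula → Set
FVAmong n φ = ∀ x → Free x φ → x < n

-- Arithmetical hierarchy (blocks of like quantifiers, possibly empty)

data QF : Formula → Set where
  qf-eq  : ∀ {t s} → QF (t ≐ s)
  qf-⊥   : QF ⊥'
  qf-imp : ∀ {φ ψ} → QF φ → QF ψ → QF (φ ⇒ ψ)
  qf-and : ∀ {φ ψ} → QF φ → QF ψ → QF (φ ∧' ψ)
  qf-or  : ∀ {φ ψ} → QF φ → QF ψ → QF (φ ∨' ψ)

mutual
  data SigmaF : ℕ → Formula → Set where
    σ-qf   : ∀ {φ} → QF φ → SigmaF zero φ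
    σ-base : ∀ {k φ} → PiF k φ → SigmaF (suc k) φ
    σ-ex   : ∀ {k φ} → SigmaF (suc k) φ → SigmaF (suc k) (∃' φ)

  data PiF : ℕ → Formula → Set where
    π-qf   : ∀ {φ} → QF φ → PiF zero φ
    π-base : ∀ {k φ} → SigmaF k φ → PiF (suc k) φ
    π-all  : ∀ {k φ} → PiF (suc k) φ → PiF (suc k) (∀' φ)

data Sign : Set where
  plus minus : Sign

flip : Sign → Sign
flip plus  = minus
flip minus = plus

perp : List Sign → List Sign
perp = map flip

initial : List Sign → Maybe Sign
initial []      = nothing
initial (a ∷ _) = just a

consUnless : Sign → List Sign → List Sign
consUnless a []            = a ∷ []
consUnless plus  (plus ∷ s)  = plus ∷ s
consUnless plus  (minus ∷ s) = plus ∷ minus ∷ s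
consUnless minus (minus ∷ s) = minus ∷ s
consUnless minus (plus ∷ s)  = minus ∷ plus ∷ s

Alt : Formula → List (List Sign)
Alt (t ≐ s)  = [] ∷ []
Alt ⊥'       = [] ∷ []
Alt (φ ⇒ ψ)  = map perp (Alt φ) ++ Alt ψ
Alt (φ ∧' ψ) = Alt φ ++ Alt ψ
Alt (φ ∨' ψ) = Alt φ ++ Alt ψ
Alt (∀' φ)   = map (consUnless minus) (Alt φ)
Alt (∃' φ)   = map (consUnless plus) (Alt φ)

deg : Formula → ℕ
deg φ = foldr _⊔_ 0 (map length (Alt φ))

F : ℕ → Formula → Set
F k φ = deg φ ≡ k

U : ℕ → Formula → Set
U zero    φ = F zero φ
U (suc k) φ = F (suc k) φ × All (λ s → length s ≡ suc k → initial s ≡ just minus) (Alt φ)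

E : ℕ → Formula → Set
E zero    φ = F zero φ
E (suc k) φ = F (suc k) φ × All (λ s → length s ≡ suc k → initial s ≡ just plus) (Alt φ)

U⁺ : ℕ → Formula → Set
U⁺ k φ = U k φ ⊎ deg φ < k

E⁺ : ℕ → Formula → Set
E⁺ k φ = E k φ ⊎ deg φ < k

-- Axioms of HA (open formulas; free variables implicitly universal)

data HAAx : Formula → Set where
  eq-refl  : ∀ t → HAAx (t ≐ t)
  eq-subst : ∀ t s φ → HAAx (t ≐ s ⇒ φ [ t ] ⇒ φ [ s ])
  succ-ne0 : ∀ t → HAAx (¬' (succT t ≐ zeroT))
  succ-inj : ∀ t s → HAAx (succT t ≐ succT s ⇒ t ≐ s)
  ax-proj  : ∀ {n} (i : Fin n) (ts : Vec Term n) → HAAx (app (proj i) ts ≐ lookup ts i)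
  ax-comp  : ∀ {n m} (f : PR m) (gs : Vec (PR n) m) (ts : Vec Term n) →
             HAAx (app (comp f gs) ts ≐ app f (Data.Vec.map (λ g → app g ts) gs))
  ax-prec0 : ∀ {n} (g : PR n) (h : PR (suc (suc n))) (ts : Vec Term n) →
             HAAx (app (prec g h) (zeroT ∷ ts) ≐ app g ts)
  ax-precS : ∀ {n} (g : PR n) (h : PR (suc (suc n))) (t : Term) (ts : Vec Term n) →
             HAAx (app (prec g h) (succT t ∷ ts) ≐ app h (t ∷ app (prec g h) (t ∷ ts) ∷ ts))
  ax-ind   : ∀ φ → HAAx (φ [ zeroT ] ⇒ ∀' (φ ⇒ subst succSub φ) ⇒ ∀' φ)

-- Schemata (instances are universally closed)

data DNE (Γ : Formula → Set) : Formula → Set where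
  dne : ∀ n φ → Γ φ → FVAmong n φ → DNE Γ (∀^ n (¬' (¬' φ) ⇒ φ))

data DNE∨ (Γ Γ' : Formula → Set) : Formula → Set where
  dne∨ : ∀ n φ ψ → Γ φ → Γ' ψ → FVAmong n φ → FVAmong n ψ →
         DNE∨ Γ Γ' (∀^ n (¬' (¬' (φ ∨' ψ)) ⇒ φ ∨' ψ))

data DNS (Γ : Formula → Set) : Formula → Set where
  dns : ∀ n φ → Γ φ → FVAmong (suc n) φ →
        DNS Γ (∀^ n (∀' (¬' (¬' φ)) ⇒ ¬' (¬' (∀' φ))))

_∪_ : (Formula → Set) → (Formula → Set) → Formula → Set
(P ∪ Q) φ = P φ ⊎ Q φ

HA+ : (Formula → Set) → Formula → Set
HA+ P = HAAx ∪ P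

infix 2 _⨾_⊢_

data _⨾_⊢_ (T : Formula → Set) (Γ : List Formula) : Formula → Set where
  ax   : ∀ {φ} → T φ → T ⨾ Γ ⊢ φ
  hyp  : ∀ {φ} → φ ∈ Γ → T ⨾ Γ ⊢ φ
  ⊥E   : ∀ {φ} → T ⨾ Γ ⊢ ⊥' → T ⨾ Γ ⊢ φ
  ⇒I   : ∀ {φ ψ} → T ⨾ (φ ∷ Γ) ⊢ ψ → T ⨾ Γ ⊢ φ ⇒ ψ
  ⇒E   : ∀ {φ ψ} → T ⨾ Γ ⊢ φ ⇒ ψ → T ⨾ Γ ⊢ φ → T ⨾ Γ ⊢ ψ
  ∧I   : ∀ {φ ψ} → T ⨾ Γ ⊢ φ → T ⨾ Γ ⊢ ψ → T ⨾ Γ ⊢ φ ∧' ψ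
  ∧E₁  : ∀ {φ ψ} → T ⨾ Γ ⊢ φ ∧' ψ → T ⨾ Γ ⊢ φ
  ∧E₂  : ∀ {φ ψ} → T ⨾ Γ ⊢ φ ∧' ψ → T ⨾ Γ ⊢ ψ
  ∨I₁  : ∀ {φ ψ} → T ⨾ Γ ⊢ φ → T ⨾ Γ ⊢ φ ∨' ψ
  ∨I₂  : ∀ {φ ψ} → T ⨾ Γ ⊢ ψ → T ⨾ Γ ⊢ φ ∨' ψ
  ∨E   : ∀ {φ ψ χ} → T ⨾ Γ ⊢ φ ∨' ψ → T ⨾ (φ ∷ Γ) ⊢ χ → T ⨾ (ψ ∷ Γ) ⊢ χ → T ⨾ Γ ⊢ χ
  ∀I   : ∀ {φ} → T ⨾ map shift Γ ⊢ φ → T ⨾ Γ ⊢ ∀' φ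
  ∀E   : ∀ {φ} → T ⨾ Γ ⊢ ∀' φ → (t : Term) → T ⨾ Γ ⊢ φ [ t ]
  ∃I   : ∀ {φ} (t : Term) → T ⨾ Γ ⊢ φ [ t ] → T ⨾ Γ ⊢ ∃' φ
  ∃E   : ∀ {φ ψ} → T ⨾ Γ ⊢ ∃' φ → T ⨾ (φ ∷ map shift Γ) ⊢ shift ψ → T ⨾ Γ ⊢ ψ

_⊢_ : (Formula → Set) → Formula → Set
T ⊢ φ = T ⨾ [] ⊢ φ

-- At level k+1 let T₁ = HA + DNE(Σ_{k+1}) + DNS(U⁺_{k+1}) and
-- T₂ = HA + DNE(Π_{k+1} ∨ Π_{k+1}); by induction on φ one shows four statements at once: over T₁ an
-- E⁺-formula is equivalent to a Σ-formula and a U⁺-formula is ¬¬-equivalent to a Π-formula, over T₂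
-- a U⁺-formula is equivalent to a Π-formula and an E⁺-formula is ¬¬-equivalent to a Σ-formula. The
-- ¬¬-versions serve antecedents of implications, which only matter up to ¬¬ once the consequent is
-- stable. Quantifiers are pulled out of prenex operands one at a time; the intuitionistically invalid
-- moves (from ∀x A → B to ∃x (A → B), using DNS for A, and from ∀x (A ∨ B) to ∀x A ∨ B) are valid
-- up to ¬¬, and outright where the target is stable. Operands of lower degree are handled by the
-- induction hypothesis on k, for which the level-k theories are interpreted in the level-(k+1) ones:
-- DNE(Π_k ∨ Π_k) follows from DNE(Σ_{k+1}) as φ ∨ ψ ↔ ∃x ((x = 0 → φ) ∧ (x ≠ 0 → ψ)), and DNS(U⁺_k)
-- holds in T₂ because U⁺_k-formulas are equivalent to Π_k-formulas, which are stable there.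
module Submission where

open import Defs
open import Data.Nat using (ℕ; zero; suc; pred; _+_; _∸_; _<_; _≤_; _⊔_; z≤n; s≤s; _<?_)
open import Data.Nat.Properties
  using (≤-refl; ≤-reflexive; ≤-trans; ≤-pred; pred-mono-≤; <-irrefl; ≤-<-trans; m≤m⊔n; m≤n⊔m; ⊔-lub; n≤1+n;
         m≤m+n; m+n∸m≡n; +-suc; +-identityʳ; ≰⇒>; m≤n⇒∃[o]m+o≡n; m≤n⇒m<n∨m≡n; n≤0⇒n≡0)
open import Data.Vec using (Vec; []; _∷_)
open import Data.List using (List; []; _∷_; map; foldr; length)
open import Data.List.Properties using (length-map)
open import Data.List.Membership.Propositional using (_∈_)
open import Data.List.Membership.Propositional.Properties using (∈-map⁺; ∈-++⁺ˡ)
open import Data.List.Relation.Binary.Subset.Propositional using (_⊆_)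
open import Data.List.Relation.Binary.Subset.Propositional.Properties using (∷⁺ʳ) renaming (map⁺ to ⊆-map⁺)
open import Data.List.Relation.Unary.Any using (here; there)
open import Data.List.Relation.Unary.All as All using (All; []; _∷_)
open import Data.List.Relation.Unary.All.Properties using (++⁺; ++⁻ˡ; ++⁻ʳ; map⁺; map⁻)
open import Data.Maybe using (just)
open import Data.Unit using (⊤; tt)
open import Data.Product using (Σ-syntax; _×_; _,_; proj₁; proj₂)
open import Data.Sum using (_⊎_; inj₁; inj₂) renaming (map to map-⊎)
open import Data.Empty using (⊥; ⊥-elim)
open import Function using (id)
open import Relation.Nullary using (yes; no)
open import Relation.Binary.PropositionalEquality
  using (_≡_; _≢_; refl; sym; trans; cong; cong₂)
  renaming (subst to transport)

infixr 9 _⊚_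
_⊚_ : (ℕ → Term) → (ℕ → Term) → ℕ → Term
(σ ⊚ τ) x = substT σ (τ x)

↑ : ℕ → Term
↑ x = var (suc x)

mutual
  substT-cong : ∀ {σ τ} → (∀ x → σ x ≡ τ x) → ∀ t → substT σ t ≡ substT τ t
  substT-cong e (var x)    = e x
  substT-cong e (app f ts) = cong (app f) (substTs-cong e ts)

  substTs-cong : ∀ {σ τ n} → (∀ x → σ x ≡ τ x) → (ts : Vec Term n) → substTs σ ts ≡ substTs τ ts
  substTs-cong e []       = refl
  substTs-cong e (t ∷ ts) = cong₂ _∷_ (substT-cong e t) (substTs-cong e ts)

mutual
  substT-⊚ : ∀ σ τ t → substT σ (substT τ t) ≡ substT (σ ⊚ τ) t
  substT-⊚ σ τ (var x)    = refl
  substT-⊚ σ τ (app f ts) = cong (app f) (substTs-⊚ σ τ ts)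

  substTs-⊚ : ∀ {n} σ τ (ts : Vec Term n) → substTs σ (substTs τ ts) ≡ substTs (σ ⊚ τ) ts
  substTs-⊚ σ τ []       = refl
  substTs-⊚ σ τ (t ∷ ts) = cong₂ _∷_ (substT-⊚ σ τ t) (substTs-⊚ σ τ ts)

mutual
  substT-var : ∀ t → substT var t ≡ t
  substT-var (var x)    = refl
  substT-var (app f ts) = cong (app f) (substTs-var ts)

  substTs-var : ∀ {n} (ts : Vec Term n) → substTs var ts ≡ ts
  substTs-var []       = refl
  substTs-var (t ∷ ts) = cong₂ _∷_ (substT-var t) (substTs-var ts)

lift-cong : ∀ {σ τ} → (∀ x → σ x ≡ τ x) → ∀ x → lift σ x ≡ lift τ x
lift-cong e zero    = refl
lift-cong e (suc x) = cong shiftT (e x)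

lift-⊚ : ∀ σ τ x → lift (σ ⊚ τ) x ≡ (lift σ ⊚ lift τ) x
lift-⊚ σ τ zero    = refl
lift-⊚ σ τ (suc x) = trans (substT-⊚ ↑ σ (τ x)) (sym (substT-⊚ (lift σ) ↑ (τ x)))

lift-var : ∀ x → lift var x ≡ var x
lift-var zero    = refl
lift-var (suc x) = refl

subst-cong : ∀ {σ τ} → (∀ x → σ x ≡ τ x) → ∀ φ → subst σ φ ≡ subst τ φ
subst-cong e (t ≐ s)  = cong₂ _≐_ (substT-cong e t) (substT-cong e s)
subst-cong e ⊥'       = refl
subst-cong e (φ ⇒ ψ)  = cong₂ _⇒_ (subst-cong e φ) (subst-cong e ψ)
subst-cong e (φ ∧' ψ) = cong₂ _∧'_ (subst-cong e φ) (subst-cong e ψ)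
subst-cong e (φ ∨' ψ) = cong₂ _∨'_ (subst-cong e φ) (subst-cong e ψ)
subst-cong e (∀' φ)   = cong ∀' (subst-cong (lift-cong e) φ)
subst-cong e (∃' φ)   = cong ∃' (subst-cong (lift-cong e) φ)

subst-⊚ : ∀ σ τ φ → subst σ (subst τ φ) ≡ subst (σ ⊚ τ) φ
subst-⊚ σ τ (t ≐ s)  = cong₂ _≐_ (substT-⊚ σ τ t) (substT-⊚ σ τ s)
subst-⊚ σ τ ⊥'       = refl
subst-⊚ σ τ (φ ⇒ ψ)  = cong₂ _⇒_ (subst-⊚ σ τ φ) (subst-⊚ σ τ ψ)
subst-⊚ σ τ (φ ∧' ψ) = cong₂ _∧'_ (subst-⊚ σ τ φ) (subst-⊚ σ τ ψ)
subst-⊚ σ τ (φ ∨' ψ) = cong₂ _∨'_ (subst-⊚ σ τ φ) (subst-⊚ σ τ ψ)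
subst-⊚ σ τ (∀' φ)   = cong ∀' (trans (subst-⊚ (lift σ) (lift τ) φ) (subst-cong (λ x → sym (lift-⊚ σ τ x)) φ))
subst-⊚ σ τ (∃' φ)   = cong ∃' (trans (subst-⊚ (lift σ) (lift τ) φ) (subst-cong (λ x → sym (lift-⊚ σ τ x)) φ))

subst-var : ∀ φ → subst var φ ≡ φ
subst-var (t ≐ s)  = cong₂ _≐_ (substT-var t) (substT-var s)
subst-var ⊥'       = refl
subst-var (φ ⇒ ψ)  = cong₂ _⇒_ (subst-var φ) (subst-var ψ)
subst-var (φ ∧' ψ) = cong₂ _∧'_ (subst-var φ) (subst-var ψ)
subst-var (φ ∨' ψ) = cong₂ _∨'_ (subst-var φ) (subst-var ψ)
subst-var (∀' φ)   = cong ∀' (trans (subst-cong lift-var φ) (subst-var φ))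
subst-var (∃' φ)   = cong ∃' (trans (subst-cong lift-var φ) (subst-var φ))

lift↑-[var0] : ∀ φ → subst (lift ↑) φ [ var 0 ] ≡ φ
lift↑-[var0] φ = trans (subst-⊚ _ _ φ) (trans (subst-cong sub0∘lift↑ φ) (subst-var φ))
  where sub0∘lift↑ : ∀ x → (sub0 (var 0) ⊚ lift ↑) x ≡ var x
        sub0∘lift↑ zero    = refl
        sub0∘lift↑ (suc x) = refl

shift-[] : ∀ φ t → shift φ [ t ] ≡ φ
shift-[] φ t = trans (subst-⊚ _ _ φ) (subst-var φ)

mutual
  FreeT-substT⁻ : ∀ {y σ} t → FreeT y (substT σ t) → Σ[ x ∈ ℕ ] FreeT x t × FreeT y (σ x)
  FreeT-substT⁻ (var x) f = x , fvar , f
  FreeT-substT⁻ (app g ts) (fapp f) with FreeTs-substTs⁻ ts f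
  ... | x , a , b = x , fapp a , b

  FreeTs-substTs⁻ : ∀ {y σ n} (ts : Vec Term n) → FreeTs y (substTs σ ts) →
                    Σ[ x ∈ ℕ ] FreeTs x ts × FreeT y (σ x)
  FreeTs-substTs⁻ (t ∷ ts) (fhere f) with FreeT-substT⁻ t f
  ... | x , a , b = x , fhere a , b
  FreeTs-substTs⁻ (t ∷ ts) (fthere f) with FreeTs-substTs⁻ ts f
  ... | x , a , b = x , fthere a , b

mutual
  FreeT-substT⁺ : ∀ {x y σ} t → FreeT x t → FreeT y (σ x) → FreeT y (substT σ t)
  FreeT-substT⁺ (var x) fvar g = g
  FreeT-substT⁺ (app f ts) (fapp h) g = fapp (FreeTs-substTs⁺ ts h g)

  FreeTs-substTs⁺ : ∀ {x y σ n} (ts : Vec Term n) → FreeTs x ts → FreeT y (σ x) → FreeTs y (substTs σ ts)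
  FreeTs-substTs⁺ (t ∷ ts) (fhere h) g = fhere (FreeT-substT⁺ t h g)
  FreeTs-substTs⁺ (t ∷ ts) (fthere h) g = fthere (FreeTs-substTs⁺ ts h g)

FreeT-shiftT⁻ : ∀ {y} t → FreeT (suc y) (shiftT t) → FreeT y t
FreeT-shiftT⁻ t f with FreeT-substT⁻ t f
... | x , a , fvar = a

Free-subst⁻ : ∀ {y σ} φ → Free y (subst σ φ) → Σ[ x ∈ ℕ ] Free x φ × FreeT y (σ x)
Free-subst⁻ (t ≐ s) (eqˡ f) with FreeT-substT⁻ t f
... | x , a , b = x , eqˡ a , b
Free-subst⁻ (t ≐ s) (eqʳ f) with FreeT-substT⁻ s f
... | x , a , b = x , eqʳ a , b
Free-subst⁻ (φ ⇒ ψ) (impˡ f) with Free-subst⁻ φ f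
... | x , a , b = x , impˡ a , b
Free-subst⁻ (φ ⇒ ψ) (impʳ f) with Free-subst⁻ ψ f
... | x , a , b = x , impʳ a , b
Free-subst⁻ (φ ∧' ψ) (andˡ f) with Free-subst⁻ φ f
... | x , a , b = x , andˡ a , b
Free-subst⁻ (φ ∧' ψ) (andʳ f) with Free-subst⁻ ψ f
... | x , a , b = x , andʳ a , b
Free-subst⁻ (φ ∨' ψ) (orˡ f) with Free-subst⁻ φ f
... | x , a , b = x , orˡ a , b
Free-subst⁻ (φ ∨' ψ) (orʳ f) with Free-subst⁻ ψ f
... | x , a , b = x , orʳ a , b
Free-subst⁻ {σ = σ} (∀' φ) (all f) with Free-subst⁻ {σ = lift σ} φ f
... | suc x , a , b = x , all a , FreeT-shiftT⁻ (σ x) b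
Free-subst⁻ {σ = σ} (∃' φ) (ex f) with Free-subst⁻ {σ = lift σ} φ f
... | suc x , a , b = x , ex a , FreeT-shiftT⁻ (σ x) b

Free-subst⁺ : ∀ {x y σ} φ → Free x φ → FreeT y (σ x) → Free y (subst σ φ)
Free-subst⁺ (t ≐ s) (eqˡ f) g = eqˡ (FreeT-substT⁺ t f g)
Free-subst⁺ (t ≐ s) (eqʳ f) g = eqʳ (FreeT-substT⁺ s f g)
Free-subst⁺ (φ ⇒ ψ) (impˡ f) g = impˡ (Free-subst⁺ φ f g)
Free-subst⁺ (φ ⇒ ψ) (impʳ f) g = impʳ (Free-subst⁺ ψ f g)
Free-subst⁺ (φ ∧' ψ) (andˡ f) g = andˡ (Free-subst⁺ φ f g)
Free-subst⁺ (φ ∧' ψ) (andʳ f) g = andʳ (Free-subst⁺ ψ f g)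
Free-subst⁺ (φ ∨' ψ) (orˡ f) g = orˡ (Free-subst⁺ φ f g)
Free-subst⁺ (φ ∨' ψ) (orʳ f) g = orʳ (Free-subst⁺ ψ f g)
Free-subst⁺ {σ = σ} (∀' φ) (all f) g = all (Free-subst⁺ {σ = lift σ} φ f (FreeT-substT⁺ (σ _) g fvar))
Free-subst⁺ {σ = σ} (∃' φ) (ex f) g = ex (Free-subst⁺ {σ = lift σ} φ f (FreeT-substT⁺ (σ _) g fvar))

Free-shift⁻ : ∀ {y} φ → Free (suc y) (shift φ) → Free y φ
Free-shift⁻ φ f with Free-subst⁻ φ f
... | x , a , fvar = a

Free-shift⁺ : ∀ {y} φ → Free y φ → Free (suc y) (shift φ)
Free-shift⁺ φ f = Free-subst⁺ φ f fvar

mutual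
  substT-id-on-FV : ∀ {σ} t → (∀ x → FreeT x t → σ x ≡ var x) → substT σ t ≡ t
  substT-id-on-FV (var x) h = h x fvar
  substT-id-on-FV (app f ts) h = cong (app f) (substTs-id-on-FV ts (λ x z → h x (fapp z)))

  substTs-id-on-FV : ∀ {σ n} (ts : Vec Term n) → (∀ x → FreeTs x ts → σ x ≡ var x) → substTs σ ts ≡ ts
  substTs-id-on-FV [] h = refl
  substTs-id-on-FV (t ∷ ts) h =
    cong₂ _∷_ (substT-id-on-FV t (λ x z → h x (fhere z))) (substTs-id-on-FV ts (λ x z → h x (fthere z)))

lift-id-on-FV : ∀ {σ} φ → (∀ x → Free (suc x) φ → σ x ≡ var x) → ∀ x → Free x φ → lift σ x ≡ var x
lift-id-on-FV φ h zero    _ = refl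
lift-id-on-FV φ h (suc x) f = cong shiftT (h x f)

subst-id-on-FV : ∀ {σ} φ → (∀ x → Free x φ → σ x ≡ var x) → subst σ φ ≡ φ
subst-id-on-FV (t ≐ s) h = cong₂ _≐_ (substT-id-on-FV t (λ x z → h x (eqˡ z))) (substT-id-on-FV s (λ x z → h x (eqʳ z)))
subst-id-on-FV ⊥' h = refl
subst-id-on-FV (φ ⇒ ψ) h = cong₂ _⇒_ (subst-id-on-FV φ (λ x z → h x (impˡ z))) (subst-id-on-FV ψ (λ x z → h x (impʳ z)))
subst-id-on-FV (φ ∧' ψ) h = cong₂ _∧'_ (subst-id-on-FV φ (λ x z → h x (andˡ z))) (subst-id-on-FV ψ (λ x z → h x (andʳ z)))
subst-id-on-FV (φ ∨' ψ) h = cong₂ _∨'_ (subst-id-on-FV φ (λ x z → h x (orˡ z))) (subst-id-on-FV ψ (λ x z → h x (orʳ z)))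
subst-id-on-FV (∀' φ) h = cong ∀' (subst-id-on-FV φ (lift-id-on-FV φ (λ x z → h x (all z))))
subst-id-on-FV (∃' φ) h = cong ∃' (subst-id-on-FV φ (lift-id-on-FV φ (λ x z → h x (ex z))))

mutual
  fvBoundT : Term → ℕ
  fvBoundT (var x)    = suc x
  fvBoundT (app f ts) = fvBoundTs ts

  fvBoundTs : ∀ {n} → Vec Term n → ℕ
  fvBoundTs []       = 0
  fvBoundTs (t ∷ ts) = fvBoundT t ⊔ fvBoundTs ts

fvBound : Formula → ℕ
fvBound (t ≐ s)  = fvBoundT t ⊔ fvBoundT s
fvBound ⊥'       = 0
fvBound (φ ⇒ ψ)  = fvBound φ ⊔ fvBound ψ
fvBound (φ ∧' ψ) = fvBound φ ⊔ fvBound ψ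
fvBound (φ ∨' ψ) = fvBound φ ⊔ fvBound ψ
fvBound (∀' φ)   = pred (fvBound φ)
fvBound (∃' φ)   = pred (fvBound φ)

mutual
  fvBoundT-sound : ∀ {x} t → FreeT x t → x < fvBoundT t
  fvBoundT-sound (var x) fvar = ≤-refl
  fvBoundT-sound (app f ts) (fapp z) = fvBoundTs-sound ts z

  fvBoundTs-sound : ∀ {x n} (ts : Vec Term n) → FreeTs x ts → x < fvBoundTs ts
  fvBoundTs-sound (t ∷ ts) (fhere z)  = ≤-trans (fvBoundT-sound t z) (m≤m⊔n _ _)
  fvBoundTs-sound (t ∷ ts) (fthere z) = ≤-trans (fvBoundTs-sound ts z) (m≤n⊔m _ _)

fvBound-sound : ∀ φ → FVAmong (fvBound φ) φ
fvBound-sound (t ≐ s) x (eqˡ z) = ≤-trans (fvBoundT-sound t z) (m≤m⊔n _ _)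
fvBound-sound (t ≐ s) x (eqʳ z) = ≤-trans (fvBoundT-sound s z) (m≤n⊔m _ _)
fvBound-sound (φ ⇒ ψ) x (impˡ z) = ≤-trans (fvBound-sound φ x z) (m≤m⊔n _ _)
fvBound-sound (φ ⇒ ψ) x (impʳ z) = ≤-trans (fvBound-sound ψ x z) (m≤n⊔m _ _)
fvBound-sound (φ ∧' ψ) x (andˡ z) = ≤-trans (fvBound-sound φ x z) (m≤m⊔n _ _)
fvBound-sound (φ ∧' ψ) x (andʳ z) = ≤-trans (fvBound-sound ψ x z) (m≤n⊔m _ _)
fvBound-sound (φ ∨' ψ) x (orˡ z) = ≤-trans (fvBound-sound φ x z) (m≤m⊔n _ _)
fvBound-sound (φ ∨' ψ) x (orʳ z) = ≤-trans (fvBound-sound ψ x z) (m≤n⊔m _ _)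
fvBound-sound (∀' φ) x (all z) = pred-mono-≤ (fvBound-sound φ (suc x) z)
fvBound-sound (∃' φ) x (ex z) = pred-mono-≤ (fvBound-sound φ (suc x) z)

cast : ∀ {T Γ φ ψ} → φ ≡ ψ → T ⨾ Γ ⊢ φ → T ⨾ Γ ⊢ ψ
cast refl d = d

weaken : ∀ {T Γ Δ φ} → Γ ⊆ Δ → T ⨾ Γ ⊢ φ → T ⨾ Δ ⊢ φ
weaken s (ax x)     = ax x
weaken s (hyp x)    = hyp (s x)
weaken s (⊥E d)     = ⊥E (weaken s d)
weaken s (⇒I d)     = ⇒I (weaken (∷⁺ʳ _ s) d)
weaken s (⇒E d e)   = ⇒E (weaken s d) (weaken s e)
weaken s (∧I d e)   = ∧I (weaken s d) (weaken s e)
weaken s (∧E₁ d)    = ∧E₁ (weaken s d)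
weaken s (∧E₂ d)    = ∧E₂ (weaken s d)
weaken s (∨I₁ d)    = ∨I₁ (weaken s d)
weaken s (∨I₂ d)    = ∨I₂ (weaken s d)
weaken s (∨E d e f) = ∨E (weaken s d) (weaken (∷⁺ʳ _ s) e) (weaken (∷⁺ʳ _ s) f)
weaken s (∀I d)     = ∀I (weaken (⊆-map⁺ shift s) d)
weaken s (∀E d t)   = ∀E (weaken s d) t
weaken s (∃I t d)   = ∃I t (weaken s d)
weaken s (∃E d e)   = ∃E (weaken s d) (weaken (∷⁺ʳ _ (⊆-map⁺ shift s)) e)

weaken-closed : ∀ {T Γ φ} → T ⊢ φ → T ⨾ Γ ⊢ φ
weaken-closed = weaken (λ ())

Interprets : (Formula → Set) → (Formula → Set) → Set
Interprets T T' = ∀ {ψ} → T ψ → T' ⊢ ψ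

interpret : ∀ {T T' Γ φ} → Interprets T T' → T ⨾ Γ ⊢ φ → T' ⨾ Γ ⊢ φ
interpret i (ax x)     = weaken-closed (i x)
interpret i (hyp x)    = hyp x
interpret i (⊥E d)     = ⊥E (interpret i d)
interpret i (⇒I d)     = ⇒I (interpret i d)
interpret i (⇒E d e)   = ⇒E (interpret i d) (interpret i e)
interpret i (∧I d e)   = ∧I (interpret i d) (interpret i e)
interpret i (∧E₁ d)    = ∧E₁ (interpret i d)
interpret i (∧E₂ d)    = ∧E₂ (interpret i d)
interpret i (∨I₁ d)    = ∨I₁ (interpret i d)
interpret i (∨I₂ d)    = ∨I₂ (interpret i d)
interpret i (∨E d e f) = ∨E (interpret i d) (interpret i e) (interpret i f)
interpret i (∀I d)     = ∀I (interpret i d)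
interpret i (∀E d t)   = ∀E (interpret i d) t
interpret i (∃I t d)   = ∃I t (interpret i d)
interpret i (∃E d e)   = ∃E (interpret i d) (interpret i e)

∀^-intro : ∀ {T} n {φ} → T ⊢ φ → T ⊢ ∀^ n φ
∀^-intro zero    d = d
∀^-intro (suc n) d = ∀I (∀^-intro n d)

liftN : ℕ → (ℕ → Term) → ℕ → Term
liftN zero    σ = σ
liftN (suc n) σ = lift (liftN n σ)

liftN-lift : ∀ n σ x → liftN n (lift σ) x ≡ lift (liftN n σ) x
liftN-lift zero    σ x = refl
liftN-lift (suc n) σ x = lift-cong (liftN-lift n σ) x

subst-∀^ : ∀ n σ φ → subst σ (∀^ n φ) ≡ ∀^ n (subst (liftN n σ) φ)
subst-∀^ zero    σ φ = refl
subst-∀^ (suc n) σ φ =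
  cong ∀' (trans (subst-∀^ n (lift σ) φ) (cong (∀^ n) (subst-cong (liftN-lift n σ) φ)))

liftN-below : ∀ n σ x → x < n → liftN n σ x ≡ var x
liftN-below (suc n) σ zero    p       = refl
liftN-below (suc n) σ (suc x) (s≤s p) = cong shiftT (liftN-below n σ x p)

liftN-above : ∀ n σ y → liftN n σ (n + y) ≡ substT (λ z → var (n + z)) (σ y)
liftN-above zero    σ y = sym (substT-var (σ y))
liftN-above (suc n) σ y = trans (cong shiftT (liftN-above n σ y)) (substT-⊚ ↑ _ (σ y))

-- Eliminating the quantifiers of ∀^ n φ with the variables they bind yields φ under collapse n:
-- x < n is bound and stays var x, while x ≥ n denotes x ∸ n outside the quantifiers.
collapse : ℕ → ℕ → Term
collapse n x with x <? n
... | yes _ = var x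
... | no  _ = var (x ∸ n)

collapse-below : ∀ n x → x < n → collapse n x ≡ var x
collapse-below n x p with x <? n
... | yes _ = refl
... | no ¬p = ⊥-elim (¬p p)

collapse-above : ∀ n y → collapse n (n + y) ≡ var y
collapse-above n y with (n + y) <? n
... | yes p = ⊥-elim (<-irrefl refl (≤-<-trans (m≤m+n n y) p))
... | no  _ = cong var (m+n∸m≡n n y)

collapse-step : ∀ n x → (collapse n ⊚ liftN n (sub0 (var n))) x ≡ collapse (suc n) x
collapse-step n x with x <? n
... | yes p = trans (cong (substT (collapse n)) (liftN-below n _ x p))
                    (trans (collapse-below n x p) (sym (collapse-below (suc n) x (≤-trans p (n≤1+n _)))))
... | no ¬p with m≤n⇒∃[o]m+o≡n (≤-pred (≰⇒> ¬p))
...   | zero , refl =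
  trans (cong (substT (collapse n)) (liftN-above n _ 0))
        (trans (collapse-above n n)
               (trans (cong var (sym (+-identityʳ n)))
                      (sym (collapse-below (suc n) (n + 0) (s≤s (≤-reflexive (+-identityʳ n)))))))
...   | suc z , refl =
  trans (cong (substT (collapse n)) (liftN-above n _ (suc z)))
        (trans (collapse-above n z) (sym (trans (cong (collapse (suc n)) (+-suc n z)) (collapse-above (suc n) z))))

∀^-elim-collapse : ∀ {T} n φ → T ⊢ ∀^ n φ → T ⊢ subst (collapse n) φ
∀^-elim-collapse zero φ d = cast (sym (trans (subst-cong (collapse-above 0) φ) (subst-var φ))) d
∀^-elim-collapse (suc n) φ d =
  cast (trans (subst-⊚ (collapse n) (liftN n (sub0 (var n))) φ) (subst-cong (collapse-step n) φ))
       (∀^-elim-collapse n (subst (liftN n (sub0 (var n))) φ) (cast (subst-∀^ n (sub0 (var n)) φ) (∀E d (var n))))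

∀^-elim : ∀ {T} n {φ} → FVAmong n φ → T ⊢ ∀^ n φ → T ⊢ φ
∀^-elim n {φ} fv d = cast (subst-id-on-FV φ (λ x f → collapse-below n x (fv x f))) (∀^-elim-collapse n φ d)

infix 3 _⇔_
_⇔_ : Formula → Formula → Formula
_⇔_ = _⇔'_

¬¬' : Formula → Formula
¬¬' φ = ¬' (¬' φ)

Stable : (Formula → Set) → Formula → Set
Stable T φ = T ⊢ (¬¬' φ ⇒ φ)

DNShift : (Formula → Set) → Formula → Set
DNShift T φ = T ⊢ (∀' (¬¬' φ) ⇒ ¬¬' (∀' φ))

pattern #0 = hyp (here refl)
pattern #1 = hyp (there (here refl))
pattern #2 = hyp (there (there (here refl)))
pattern #3 = hyp (there (there (there (here refl))))

module _ {T : Formula → Set} where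

  ⇔-to : ∀ {φ ψ} → T ⊢ (φ ⇔ ψ) → T ⊢ (φ ⇒ ψ)
  ⇔-to = ∧E₁

  ⇔-from : ∀ {φ ψ} → T ⊢ (φ ⇔ ψ) → T ⊢ (ψ ⇒ φ)
  ⇔-from = ∧E₂

  apply : ∀ {Γ φ ψ} → T ⊢ (φ ⇒ ψ) → T ⨾ Γ ⊢ φ → T ⨾ Γ ⊢ ψ
  apply f d = ⇒E (weaken-closed f) d

  ⇒-refl : ∀ {φ} → T ⊢ (φ ⇒ φ)
  ⇒-refl = ⇒I #0

  ⇒-trans : ∀ {φ ψ χ} → T ⊢ (φ ⇒ ψ) → T ⊢ (ψ ⇒ χ) → T ⊢ (φ ⇒ χ)
  ⇒-trans f g = ⇒I (apply g (apply f #0))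

  ⇔-refl : ∀ {φ} → T ⊢ (φ ⇔ φ)
  ⇔-refl = ∧I ⇒-refl ⇒-refl

  ⇔-sym : ∀ {φ ψ} → T ⊢ (φ ⇔ ψ) → T ⊢ (ψ ⇔ φ)
  ⇔-sym e = ∧I (⇔-from e) (⇔-to e)

  ⇔-trans : ∀ {φ ψ χ} → T ⊢ (φ ⇔ ψ) → T ⊢ (ψ ⇔ χ) → T ⊢ (φ ⇔ χ)
  ⇔-trans e f = ∧I (⇒-trans (⇔-to e) (⇔-to f)) (⇒-trans (⇔-from f) (⇔-from e))

  ∀E-var0 : ∀ {Γ φ} → T ⨾ Γ ⊢ shift (∀' φ) → T ⨾ Γ ⊢ φ
  ∀E-var0 {φ = φ} d = cast (lift↑-[var0] φ) (∀E d (var 0))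

  ∃I-var0 : ∀ {Γ φ} → T ⨾ Γ ⊢ φ → T ⨾ Γ ⊢ shift (∃' φ)
  ∃I-var0 {φ = φ} d = ∃I (var 0) (cast (sym (lift↑-[var0] φ)) d)

  ∀-mono : ∀ {φ ψ} → T ⊢ (φ ⇒ ψ) → T ⊢ (∀' φ ⇒ ∀' ψ)
  ∀-mono d = ⇒I (∀I (apply d (∀E-var0 #0)))

  ∃-mono : ∀ {φ ψ} → T ⊢ (φ ⇒ ψ) → T ⊢ (∃' φ ⇒ ∃' ψ)
  ∃-mono d = ⇒I (∃E #0 (∃I-var0 (apply d #0)))

  ∧-mono : ∀ {φ φ' ψ ψ'} → T ⊢ (φ ⇒ φ') → T ⊢ (ψ ⇒ ψ') → T ⊢ (φ ∧' ψ ⇒ φ' ∧' ψ')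
  ∧-mono d e = ⇒I (∧I (apply d (∧E₁ #0)) (apply e (∧E₂ #0)))

  ∨-mono : ∀ {φ φ' ψ ψ'} → T ⊢ (φ ⇒ φ') → T ⊢ (ψ ⇒ ψ') → T ⊢ (φ ∨' ψ ⇒ φ' ∨' ψ')
  ∨-mono d e = ⇒I (∨E #0 (∨I₁ (apply d #0)) (∨I₂ (apply e #0)))

  ⇒-mono : ∀ {φ φ' ψ ψ'} → T ⊢ (φ' ⇒ φ) → T ⊢ (ψ ⇒ ψ') → T ⊢ ((φ ⇒ ψ) ⇒ (φ' ⇒ ψ'))
  ⇒-mono d e = ⇒I (⇒I (apply e (⇒E #1 (apply d #0))))

  ∀-cong : ∀ {φ ψ} → T ⊢ (φ ⇔ ψ) → T ⊢ (∀' φ ⇔ ∀' ψ)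
  ∀-cong e = ∧I (∀-mono (⇔-to e)) (∀-mono (⇔-from e))

  ∃-cong : ∀ {φ ψ} → T ⊢ (φ ⇔ ψ) → T ⊢ (∃' φ ⇔ ∃' ψ)
  ∃-cong e = ∧I (∃-mono (⇔-to e)) (∃-mono (⇔-from e))

  ∧-cong : ∀ {φ φ' ψ ψ'} → T ⊢ (φ ⇔ φ') → T ⊢ (ψ ⇔ ψ') → T ⊢ (φ ∧' ψ ⇔ φ' ∧' ψ')
  ∧-cong e f = ∧I (∧-mono (⇔-to e) (⇔-to f)) (∧-mono (⇔-from e) (⇔-from f))

  ∨-cong : ∀ {φ φ' ψ ψ'} → T ⊢ (φ ⇔ φ') → T ⊢ (ψ ⇔ ψ') → T ⊢ (φ ∨' ψ ⇔ φ' ∨' ψ')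
  ∨-cong e f = ∧I (∨-mono (⇔-to e) (⇔-to f)) (∨-mono (⇔-from e) (⇔-from f))

  ⇒-cong : ∀ {φ φ' ψ ψ'} → T ⊢ (φ ⇔ φ') → T ⊢ (ψ ⇔ ψ') → T ⊢ ((φ ⇒ ψ) ⇔ (φ' ⇒ ψ'))
  ⇒-cong e f = ∧I (⇒-mono (⇔-from e) (⇔-to f)) (⇒-mono (⇔-to e) (⇔-from f))

  ∀-∧ˡ : ∀ φ ψ → T ⊢ (∀' φ ∧' ψ ⇔ ∀' (φ ∧' shift ψ))
  ∀-∧ˡ φ ψ = ∧I (⇒I (∀I (∧I (∀E-var0 (∧E₁ #0)) (∧E₂ #0))))
                (⇒I (∧I (∀I (∧E₁ (∀E-var0 #0))) (cast (shift-[] ψ zeroT) (∧E₂ (∀E #0 zeroT)))))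

  ∀-∧ʳ : ∀ φ ψ → T ⊢ (ψ ∧' ∀' φ ⇔ ∀' (shift ψ ∧' φ))
  ∀-∧ʳ φ ψ = ∧I (⇒I (∀I (∧I (∧E₁ #0) (∀E-var0 (∧E₂ #0)))))
                (⇒I (∧I (cast (shift-[] ψ zeroT) (∧E₁ (∀E #0 zeroT))) (∀I (∧E₂ (∀E-var0 #0)))))

  ∃-∧ˡ : ∀ φ ψ → T ⊢ (∃' φ ∧' ψ ⇔ ∃' (φ ∧' shift ψ))
  ∃-∧ˡ φ ψ = ∧I (⇒I (∃E (∧E₁ #0) (∃I-var0 (∧I #0 (∧E₂ #1)))))
                (⇒I (∃E #0 (∧I (∃I-var0 (∧E₁ #0)) (∧E₂ #0))))

  ∃-∧ʳ : ∀ φ ψ → T ⊢ (ψ ∧' ∃' φ ⇔ ∃' (shift ψ ∧' φ))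
  ∃-∧ʳ φ ψ = ∧I (⇒I (∃E (∧E₂ #0) (∃I-var0 (∧I (∧E₁ #1) #0))))
                (⇒I (∃E #0 (∧I (∧E₁ #0) (∃I-var0 (∧E₂ #0)))))

  ∃-∨ˡ : ∀ φ ψ → T ⊢ (∃' φ ∨' ψ ⇔ ∃' (φ ∨' shift ψ))
  ∃-∨ˡ φ ψ = ∧I (⇒I (∨E #0 (∃E #0 (∃I-var0 (∨I₁ #0))) (∃I zeroT (∨I₂ (cast (sym (shift-[] ψ zeroT)) #0)))))
                (⇒I (∃E #0 (∨E #0 (∨I₁ (∃I-var0 #0)) (∨I₂ #0))))

  ∃-∨ʳ : ∀ φ ψ → T ⊢ (ψ ∨' ∃' φ ⇔ ∃' (shift ψ ∨' φ))
  ∃-∨ʳ φ ψ = ∧I (⇒I (∨E #0 (∃I zeroT (∨I₁ (cast (sym (shift-[] ψ zeroT)) #0))) (∃E #0 (∃I-var0 (∨I₂ #0)))))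
                (⇒I (∃E #0 (∨E #0 (∨I₁ #0) (∨I₂ (∃I-var0 #0)))))

  ∃-⇒ˡ : ∀ φ ψ → T ⊢ ((∃' φ ⇒ ψ) ⇔ ∀' (φ ⇒ shift ψ))
  ∃-⇒ˡ φ ψ = ∧I (⇒I (∀I (⇒I (⇒E #1 (∃I-var0 #0)))))
                (⇒I (⇒I (∃E #0 (⇒E (∀E-var0 #2) #0))))

  ∀-⇒ʳ : ∀ φ ψ → T ⊢ ((ψ ⇒ ∀' φ) ⇔ ∀' (shift ψ ⇒ φ))
  ∀-⇒ʳ φ ψ = ∧I (⇒I (∀I (⇒I (∀E-var0 (⇒E #1 #0)))))
                (⇒I (⇒I (∀I (⇒E (∀E-var0 #1) #0))))

  ∀-⇒ˡ-⇐ : ∀ φ ψ → T ⊢ (∃' (φ ⇒ shift ψ) ⇒ (∀' φ ⇒ ψ))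
  ∀-⇒ˡ-⇐ φ ψ = ⇒I (⇒I (∃E #1 (⇒E #0 (∀E-var0 #1))))

  ∃-⇒ʳ-⇐ : ∀ φ ψ → T ⊢ (∃' (shift ψ ⇒ φ) ⇒ (ψ ⇒ ∃' φ))
  ∃-⇒ʳ-⇐ φ ψ = ⇒I (⇒I (∃E #1 (∃I-var0 (⇒E #0 #1))))

  ∀-∨ˡ-⇒ : ∀ φ ψ → T ⊢ (∀' φ ∨' ψ ⇒ ∀' (φ ∨' shift ψ))
  ∀-∨ˡ-⇒ φ ψ = ⇒I (∀I (∨E #0 (∨I₁ (∀E-var0 #0)) (∨I₂ #0)))

  ∀-∨ʳ-⇒ : ∀ φ ψ → T ⊢ (ψ ∨' ∀' φ ⇒ ∀' (shift ψ ∨' φ))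
  ∀-∨ʳ-⇒ φ ψ = ⇒I (∀I (∨E #0 (∨I₁ #0) (∨I₂ (∀E-var0 #0))))

  ∃-⇒ʳ-decidable : ∀ {δ} φ → T ⊢ (δ ∨' ¬' δ) → T ⊢ ((δ ⇒ ∃' φ) ⇔ ∃' (shift δ ⇒ φ))
  ∃-⇒ʳ-decidable {δ} φ dec =
    ∧I (⇒I (∨E (weaken-closed dec) (∃E (⇒E #1 #0) (∃I-var0 (⇒I #1)))
                                   (∃I zeroT (⇒I (⊥E (⇒E #1 (cast (shift-[] δ zeroT) #0)))))))
       (∃-⇒ʳ-⇐ φ δ)

  ¬¬-intro : ∀ {φ} → T ⊢ (φ ⇒ ¬¬' φ)
  ¬¬-intro = ⇒I (⇒I (⇒E #0 #1))

  ¬¬-mono : ∀ {φ ψ} → T ⊢ (φ ⇒ ψ) → T ⊢ (¬¬' φ ⇒ ¬¬' ψ)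
  ¬¬-mono f = ⇒I (⇒I (⇒E #1 (⇒I (⇒E #1 (apply f #0)))))

  ¬¬-cong : ∀ {φ ψ} → T ⊢ (φ ⇔ ψ) → T ⊢ (¬¬' φ ⇔ ¬¬' ψ)
  ¬¬-cong e = ∧I (¬¬-mono (⇔-to e)) (¬¬-mono (⇔-from e))

  ¬¬-bind : ∀ {φ ψ} → T ⊢ (φ ⇒ ¬¬' ψ) → T ⊢ (¬¬' φ ⇒ ¬¬' ψ)
  ¬¬-bind f = ⇒-trans (¬¬-mono f) (⇒I (⇒I (⇒E #1 (⇒I (⇒E #0 #1)))))

  ¬¬-apply : ∀ {Γ φ ψ} → T ⨾ Γ ⊢ φ ⇒ ψ → T ⨾ Γ ⊢ ¬¬' φ → T ⨾ Γ ⊢ ¬¬' ψ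
  ¬¬-apply f d = ⇒I (⇒E (weaken there d) (⇒I (⇒E #1 (⇒E (weaken (λ m → there (there m)) f) #0))))

  ¬¬-∧ : ∀ {φ ψ} → T ⊢ (¬¬' (φ ∧' ψ) ⇔ ¬¬' φ ∧' ¬¬' ψ)
  ¬¬-∧ = ∧I (⇒I (∧I (apply (¬¬-mono (⇒I (∧E₁ #0))) #0) (apply (¬¬-mono (⇒I (∧E₂ #0))) #0)))
            (⇒I (⇒I (⇒E (∧E₁ #1) (⇒I (⇒E (∧E₂ #2) (⇒I (⇒E #2 (∧I #1 #0))))))))

  ¬¬-⇒ : ∀ {φ ψ} → T ⊢ (¬¬' (φ ⇒ ψ) ⇔ (¬¬' φ ⇒ ¬¬' ψ))
  ¬¬-⇒ = ∧I (⇒I (⇒I (⇒I (⇒E #1 (⇒I (⇒E #3 (⇒I (⇒E #2 (⇒E #0 #1)))))))))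
            (⇒I (⇒I (⇒E (⇒E #1 (⇒I (⇒E #1 (⇒I (⊥E (⇒E #1 #0)))))) (⇒I (⇒E #1 (⇒I #1))))))

  ¬¬-∨ : ∀ {φ ψ} → T ⊢ (¬¬' (φ ∨' ψ) ⇔ ¬¬' (¬¬' φ ∨' ¬¬' ψ))
  ¬¬-∨ = ∧I (¬¬-mono (∨-mono ¬¬-intro ¬¬-intro))
            (¬¬-bind (⇒I (∨E #0 (apply (¬¬-mono (⇒I (∨I₁ #0))) #0) (apply (¬¬-mono (⇒I (∨I₂ #0))) #0))))

  ¬¬-∃ : ∀ {φ} → T ⊢ (¬¬' (∃' φ) ⇔ ¬¬' (∃' (¬¬' φ)))
  ¬¬-∃ = ∧I (¬¬-mono (∃-mono ¬¬-intro)) (¬¬-bind (⇒I (∃E #0 (apply (¬¬-mono (⇒I (∃I-var0 #0))) #0))))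

  ¬¬-∀ : ∀ {φ} → T ⊢ (¬¬' (∀' φ) ⇒ ∀' (¬¬' φ))
  ¬¬-∀ = ⇒I (∀I (apply (¬¬-mono (⇒I (∀E-var0 #0))) #0))

  ¬¬-∧-cong : ∀ {φ φ' ψ ψ'} → T ⊢ (¬¬' φ ⇔ ¬¬' φ') → T ⊢ (¬¬' ψ ⇔ ¬¬' ψ') →
              T ⊢ (¬¬' (φ ∧' ψ) ⇔ ¬¬' (φ' ∧' ψ'))
  ¬¬-∧-cong e f = ⇔-trans ¬¬-∧ (⇔-trans (∧-cong e f) (⇔-sym ¬¬-∧))

  ¬¬-⇒-cong : ∀ {φ φ' ψ ψ'} → T ⊢ (¬¬' φ ⇔ ¬¬' φ') → T ⊢ (¬¬' ψ ⇔ ¬¬' ψ') →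
              T ⊢ (¬¬' (φ ⇒ ψ) ⇔ ¬¬' (φ' ⇒ ψ'))
  ¬¬-⇒-cong e f = ⇔-trans ¬¬-⇒ (⇔-trans (⇒-cong e f) (⇔-sym ¬¬-⇒))

  ¬¬-∨-cong : ∀ {φ φ' ψ ψ'} → T ⊢ (¬¬' φ ⇔ ¬¬' φ') → T ⊢ (¬¬' ψ ⇔ ¬¬' ψ') →
              T ⊢ (¬¬' (φ ∨' ψ) ⇔ ¬¬' (φ' ∨' ψ'))
  ¬¬-∨-cong e f = ⇔-trans ¬¬-∨ (⇔-trans (¬¬-cong (∨-cong e f)) (⇔-sym ¬¬-∨))

  ¬¬-∃-cong : ∀ {φ φ'} → T ⊢ (¬¬' φ ⇔ ¬¬' φ') → T ⊢ (¬¬' (∃' φ) ⇔ ¬¬' (∃' φ'))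
  ¬¬-∃-cong e = ⇔-trans ¬¬-∃ (⇔-trans (¬¬-cong (∃-cong e)) (⇔-sym ¬¬-∃))

  ¬¬-∀-cong : ∀ {φ φ'} → DNShift T φ → DNShift T φ' → T ⊢ (¬¬' φ ⇔ ¬¬' φ') →
              T ⊢ (¬¬' (∀' φ) ⇔ ¬¬' (∀' φ'))
  ¬¬-∀-cong d d' e =
    ∧I (⇒-trans ¬¬-∀ (⇒-trans (∀-mono (⇔-to e)) d')) (⇒-trans ¬¬-∀ (⇒-trans (∀-mono (⇔-from e)) d))

  Stable-⇔ : ∀ {φ ψ} → T ⊢ (φ ⇔ ψ) → Stable T ψ → Stable T φ
  Stable-⇔ e s = ⇒-trans (¬¬-mono (⇔-to e)) (⇒-trans s (⇔-from e))

  ⇒-cong-stable : ∀ {φ φ' ψ ψ'} → T ⊢ (¬¬' φ ⇔ ¬¬' φ') → T ⊢ (ψ ⇔ ψ') → Stable T ψ' →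
                  T ⊢ ((φ ⇒ ψ) ⇔ (φ' ⇒ ψ'))
  ⇒-cong-stable e f s =
    ∧I (⇒I (⇒I (apply s (apply (¬¬-mono (⇔-to f)) (¬¬-apply #1 (apply (⇔-from e) (apply ¬¬-intro #0)))))))
       (⇒I (⇒I (apply (⇔-from f) (apply s (¬¬-apply #1 (apply (⇔-to e) (apply ¬¬-intro #0)))))))

  ∀-⇒ˡ-⇒¬¬ : ∀ φ ψ → DNShift T φ → T ⊢ ((∀' φ ⇒ ψ) ⇒ ¬¬' (∃' (φ ⇒ shift ψ)))
  ∀-⇒ˡ-⇒¬¬ φ ψ shiftφ = ⇒I (⇒I (⇒E (apply shiftφ ∀¬¬φ) (⇒I (⇒E ¬ψ (⇒E #2 #0)))))
    where
    ∀¬¬φ : T ⨾ ¬' (∃' (φ ⇒ shift ψ)) ∷ (∀' φ ⇒ ψ) ∷ [] ⊢ ∀' (¬¬' φ)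
    ∀¬¬φ = ∀I (⇒I (⇒E #1 (∃I-var0 (⇒I (⊥E (⇒E #1 #0))))))
    ¬ψ : T ⨾ ∀' φ ∷ ¬' (∃' (φ ⇒ shift ψ)) ∷ (∀' φ ⇒ ψ) ∷ [] ⊢ ¬' ψ
    ¬ψ = ⇒I (⇒E #2 (∃I zeroT (⇒I (cast (sym (shift-[] ψ zeroT)) #1))))

  ∃-⇒ʳ-⇒¬¬ : ∀ φ ψ → T ⊢ ((ψ ⇒ ∃' φ) ⇒ ¬¬' (∃' (shift ψ ⇒ φ)))
  ∃-⇒ʳ-⇒¬¬ φ ψ = ⇒I (⇒I (⇒E ¬¬ψ ¬ψ))
    where
    ¬¬ψ : T ⨾ ¬' (∃' (shift ψ ⇒ φ)) ∷ (ψ ⇒ ∃' φ) ∷ [] ⊢ ¬¬' ψ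
    ¬¬ψ = ⇒I (⇒E #1 (∃I zeroT (⇒I (⊥E (⇒E #1 (cast (shift-[] ψ zeroT) #0))))))
    ¬ψ : T ⨾ ¬' (∃' (shift ψ ⇒ φ)) ∷ (ψ ⇒ ∃' φ) ∷ [] ⊢ ¬' ψ
    ¬ψ = ⇒I (⇒E (⇒I (∃E #0 (⇒E #3 (∃I-var0 (⇒I #1))))) (⇒E #2 #0))

  ∀-∨ˡ-⇐¬¬ : ∀ φ ψ → T ⊢ (∀' (φ ∨' shift ψ) ⇒ ¬¬' (∀' φ ∨' ψ))
  ∀-∨ˡ-⇐¬¬ φ ψ = ⇒I (⇒I (⇒E #0 (∨I₁ (∀I (∨E (∀E-var0 #1) #0 (⊥E (⇒E #1 (∨I₂ #0))))))))

  ∀-∨ʳ-⇐¬¬ : ∀ φ ψ → T ⊢ (∀' (shift ψ ∨' φ) ⇒ ¬¬' (ψ ∨' ∀' φ))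
  ∀-∨ʳ-⇐¬¬ φ ψ = ⇒I (⇒I (⇒E #0 (∨I₂ (∀I (∨E (∀E-var0 #1) (⊥E (⇒E #1 (∨I₁ #0))) #0)))))

  Stable→DNShift : ∀ {φ} → Stable T φ → DNShift T φ
  Stable→DNShift s = ⇒-trans (∀-mono s) ¬¬-intro

  ∀-∨ˡ-stable : ∀ φ ψ → Stable T (∀' φ ∨' ψ) → T ⊢ (∀' φ ∨' ψ ⇔ ∀' (φ ∨' shift ψ))
  ∀-∨ˡ-stable φ ψ s = ∧I (∀-∨ˡ-⇒ φ ψ) (⇒-trans (∀-∨ˡ-⇐¬¬ φ ψ) s)

  ∀-∨ʳ-stable : ∀ φ ψ → Stable T (ψ ∨' ∀' φ) → T ⊢ (ψ ∨' ∀' φ ⇔ ∀' (shift ψ ∨' φ))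
  ∀-∨ʳ-stable φ ψ s = ∧I (∀-∨ʳ-⇒ φ ψ) (⇒-trans (∀-∨ʳ-⇐¬¬ φ ψ) s)

  ¬¬-∀-∨ˡ : ∀ φ ψ → T ⊢ (¬¬' (∀' φ ∨' ψ) ⇔ ¬¬' (∀' (φ ∨' shift ψ)))
  ¬¬-∀-∨ˡ φ ψ = ∧I (¬¬-mono (∀-∨ˡ-⇒ φ ψ)) (¬¬-bind (∀-∨ˡ-⇐¬¬ φ ψ))

  ¬¬-∀-∨ʳ : ∀ φ ψ → T ⊢ (¬¬' (ψ ∨' ∀' φ) ⇔ ¬¬' (∀' (shift ψ ∨' φ)))
  ¬¬-∀-∨ʳ φ ψ = ∧I (¬¬-mono (∀-∨ʳ-⇒ φ ψ)) (¬¬-bind (∀-∨ʳ-⇐¬¬ φ ψ))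

  ∀-⇒ˡ-stable : ∀ φ ψ → DNShift T φ → Stable T (∃' (φ ⇒ shift ψ)) → T ⊢ ((∀' φ ⇒ ψ) ⇔ ∃' (φ ⇒ shift ψ))
  ∀-⇒ˡ-stable φ ψ d s = ∧I (⇒-trans (∀-⇒ˡ-⇒¬¬ φ ψ d) s) (∀-⇒ˡ-⇐ φ ψ)

  ¬¬-∀-⇒ˡ : ∀ φ ψ → DNShift T φ → T ⊢ (¬¬' (∀' φ ⇒ ψ) ⇔ ¬¬' (∃' (φ ⇒ shift ψ)))
  ¬¬-∀-⇒ˡ φ ψ d = ∧I (¬¬-bind (∀-⇒ˡ-⇒¬¬ φ ψ d)) (¬¬-mono (∀-⇒ˡ-⇐ φ ψ))

  ∃-⇒ʳ-stable : ∀ φ ψ → Stable T (∃' (shift ψ ⇒ φ)) → T ⊢ ((ψ ⇒ ∃' φ) ⇔ ∃' (shift ψ ⇒ φ))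
  ∃-⇒ʳ-stable φ ψ s = ∧I (⇒-trans (∃-⇒ʳ-⇒¬¬ φ ψ) s) (∃-⇒ʳ-⇐ φ ψ)

  ¬¬-∃-⇒ʳ : ∀ φ ψ → T ⊢ (¬¬' (ψ ⇒ ∃' φ) ⇔ ¬¬' (∃' (shift ψ ⇒ φ)))
  ¬¬-∃-⇒ʳ φ ψ = ∧I (¬¬-bind (∃-⇒ʳ-⇒¬¬ φ ψ)) (¬¬-mono (∃-⇒ʳ-⇐ φ ψ))

isZero : ℕ → Formula
isZero i = var i ≐ zeroT

module _ {T : Formula → Set} (hax : ∀ {φ} → HAAx φ → T φ) where

  isZero-decidable : ∀ i → T ⊢ (isZero i ∨' ¬' (isZero i))
  isZero-decidable i =
    ∀E (⇒E (⇒E (ax (hax (ax-ind (isZero 0 ∨' ¬' (isZero 0))))) (∨I₁ (ax (hax (eq-refl zeroT)))))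
           (∀I (⇒I (∨I₂ (ax (hax (succ-ne0 (var 0))))))))
       (var i)

  ∨-as-∃ : ∀ φ ψ → T ⊢ (φ ∨' ψ ⇔ ∃' ((isZero 0 ⇒ shift φ) ∧' (¬' (isZero 0) ⇒ shift ψ)))
  ∨-as-∃ φ ψ =
    ∧I (⇒I (∨E #0 (∃I zeroT (∧I (⇒I (cast (sym (shift-[] φ zeroT)) #1))
                                (⇒I (⊥E (⇒E #0 (ax (hax (eq-refl zeroT))))))))
                  (∃I (succT zeroT) (∧I (⇒I (⊥E (⇒E (ax (hax (succ-ne0 zeroT))) #0)))
                                        (⇒I (cast (sym (shift-[] ψ (succT zeroT))) #1))))))
       (⇒I (∃E #0 (∨E (weaken-closed (isZero-decidable 0)) (∨I₁ (⇒E (∧E₁ #1) #0)) (∨I₂ (⇒E (∧E₂ #1) #0)))))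

SameFV-refl : ∀ {φ} → SameFV φ φ
SameFV-refl x = id , id

SameFV-trans : ∀ {φ ψ χ} → SameFV φ ψ → SameFV ψ χ → SameFV φ χ
SameFV-trans e f x = (λ z → proj₁ (f x) (proj₁ (e x) z)) , (λ z → proj₂ (e x) (proj₂ (f x) z))

data Connective : Set where
  and or imp : Connective

conn : Connective → Formula → Formula → Formula
conn and φ ψ = φ ∧' ψ
conn or  φ ψ = φ ∨' ψ
conn imp φ ψ = φ ⇒ ψ

data Quantifier : Set where
  universal existential : Quantifier

quant : Quantifier → Formula → Formula
quant universal φ = ∀' φ
quant existential φ = ∃' φ

Free-conn⁻ : ∀ {x} o {φ ψ} → Free x (conn o φ ψ) → Free x φ ⊎ Free x ψ
Free-conn⁻ and (andˡ f) = inj₁ f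
Free-conn⁻ and (andʳ f) = inj₂ f
Free-conn⁻ or  (orˡ f)  = inj₁ f
Free-conn⁻ or  (orʳ f)  = inj₂ f
Free-conn⁻ imp (impˡ f) = inj₁ f
Free-conn⁻ imp (impʳ f) = inj₂ f

Free-conn⁺ : ∀ {x} o {φ ψ} → Free x φ ⊎ Free x ψ → Free x (conn o φ ψ)
Free-conn⁺ and (inj₁ f) = andˡ f
Free-conn⁺ and (inj₂ f) = andʳ f
Free-conn⁺ or  (inj₁ f) = orˡ f
Free-conn⁺ or  (inj₂ f) = orʳ f
Free-conn⁺ imp (inj₁ f) = impˡ f
Free-conn⁺ imp (inj₂ f) = impʳ f

Free-quant⁻ : ∀ {x} q {φ} → Free x (quant q φ) → Free (suc x) φ
Free-quant⁻ universal (all f) = f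
Free-quant⁻ existential (ex f)  = f

Free-quant⁺ : ∀ {x} q {φ} → Free (suc x) φ → Free x (quant q φ)
Free-quant⁺ universal f = all f
Free-quant⁺ existential f = ex f

SameFV-conn : ∀ o {φ φ' ψ ψ'} → SameFV φ φ' → SameFV ψ ψ' → SameFV (conn o φ ψ) (conn o φ' ψ')
SameFV-conn o e f x = (λ z → Free-conn⁺ o (map-⊎ (proj₁ (e x)) (proj₁ (f x)) (Free-conn⁻ o z)))
                    , (λ z → Free-conn⁺ o (map-⊎ (proj₂ (e x)) (proj₂ (f x)) (Free-conn⁻ o z)))

SameFV-quant : ∀ q {φ φ'} → SameFV φ φ' → SameFV (quant q φ) (quant q φ')
SameFV-quant q e x = (λ z → Free-quant⁺ q (proj₁ (e (suc x)) (Free-quant⁻ q z)))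
                   , (λ z → Free-quant⁺ q (proj₂ (e (suc x)) (Free-quant⁻ q z)))

SameFV-pullˡ : ∀ o q q' φ ψ → SameFV (conn o (quant q φ) ψ) (quant q' (conn o φ (shift ψ)))
SameFV-pullˡ o q q' φ ψ x =
  (λ z → Free-quant⁺ q' (Free-conn⁺ o (map-⊎ (Free-quant⁻ q) (Free-shift⁺ ψ) (Free-conn⁻ o z))))
  , (λ z → Free-conn⁺ o (map-⊎ (Free-quant⁺ q) (Free-shift⁻ ψ) (Free-conn⁻ o (Free-quant⁻ q' z))))

SameFV-pullʳ : ∀ o q q' φ ψ → SameFV (conn o ψ (quant q φ)) (quant q' (conn o (shift ψ) φ))
SameFV-pullʳ o q q' φ ψ x =
  (λ z → Free-quant⁺ q' (Free-conn⁺ o (map-⊎ (Free-shift⁺ ψ) (Free-quant⁻ q) (Free-conn⁻ o z))))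
  , (λ z → Free-conn⁺ o (map-⊎ (Free-shift⁻ ψ) (Free-quant⁺ q) (Free-conn⁻ o (Free-quant⁻ q' z))))

StartsWith : Sign → List Sign → Set
StartsWith a []      = ⊤
StartsWith a (b ∷ _) = b ≡ a

Admissible : Sign → ℕ → List Sign → Set
Admissible a k s = length s ≤ k × (length s ≡ k → StartsWith a s)

-- E⁺ k and U⁺ k uniformly in the sign: Graded plus k is E⁺ k and Graded minus k is U⁺ k.
record Graded (a : Sign) (k : ℕ) (φ : Formula) : Set where
  constructor graded
  field paths : All (Admissible a k) (Alt φ)
open Graded

HeadedAt : Sign → ℕ → Formula → Set
HeadedAt a k φ = All (λ s → length s ≡ k → initial s ≡ just a) (Alt φ)

maxLength-bound : (L : List (List Sign)) → All (λ s → length s ≤ foldr _⊔_ 0 (map length L)) L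
maxLength-bound [] = []
maxLength-bound (s ∷ L) = m≤m⊔n _ _ ∷ All.map (λ p → ≤-trans p (m≤n⊔m (length s) _)) (maxLength-bound L)

maxLength-least : ∀ {k} (L : List (List Sign)) → All (λ s → length s ≤ k) L → foldr _⊔_ 0 (map length L) ≤ k
maxLength-least [] [] = z≤n
maxLength-least (s ∷ L) (p ∷ ps) = ⊔-lub p (maxLength-least L ps)

path≤deg : ∀ φ → All (λ s → length s ≤ deg φ) (Alt φ)
path≤deg φ = maxLength-bound (Alt φ)

Graded-deg : ∀ {a k φ} → Graded a k φ → deg φ ≤ k
Graded-deg {φ = φ} g = maxLength-least (Alt φ) (All.map proj₁ (paths g))

Graded-below : ∀ {a k} φ → deg φ < k → Graded a k φ
Graded-below φ lt = graded (All.map (λ p → ≤-trans p (≤-trans (n≤1+n _) lt) , (λ e → ⊥-elim (<-irrefl e (≤-<-trans p lt))))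
                                    (path≤deg φ))

Graded-F0 : ∀ {a} φ → F 0 φ → Graded a 0 φ
Graded-F0 φ d = graded (All.map (λ {s} p → ≤-trans p (≤-reflexive d) , startsWith-empty s) (path≤deg φ))
  where startsWith-empty : ∀ {a} s → length s ≡ 0 → StartsWith a s
        startsWith-empty [] _ = tt

Graded-top : ∀ {a k} φ → F (suc k) φ → HeadedAt a (suc k) φ → Graded a (suc k) φ
Graded-top φ d h =
  graded (All.zipWith (λ { {s} (p , q) → ≤-trans p (≤-reflexive d) , λ e → initial→StartsWith s (q e) }) (path≤deg φ , h))
  where initial→StartsWith : ∀ {a} s → initial s ≡ just a → StartsWith a s
        initial→StartsWith (b ∷ s) refl = refl

Graded-split : ∀ {a k φ} → Graded a (suc k) φ → deg φ < suc k ⊎ (F (suc k) φ × HeadedAt a (suc k) φ)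
Graded-split g with m≤n⇒m<n∨m≡n (Graded-deg g)
... | inj₁ lt = inj₁ lt
... | inj₂ d  = inj₂ (d , All.map (λ { {b ∷ s} (p , q) e → cong just (q e) }) (paths g))

E⁺→Graded : ∀ k φ → E⁺ k φ → Graded plus k φ
E⁺→Graded zero    φ (inj₁ d)       = Graded-F0 φ d
E⁺→Graded (suc k) φ (inj₁ (d , h)) = Graded-top φ d h
E⁺→Graded (suc k) φ (inj₂ lt)      = Graded-below φ lt

U⁺→Graded : ∀ k φ → U⁺ k φ → Graded minus k φ
U⁺→Graded zero    φ (inj₁ d)       = Graded-F0 φ d
U⁺→Graded (suc k) φ (inj₁ (d , h)) = Graded-top φ d h
U⁺→Graded (suc k) φ (inj₂ lt)      = Graded-below φ lt

Graded→E⁺ : ∀ k φ → Graded plus k φ → E⁺ k φ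
Graded→E⁺ zero    φ g = inj₁ (n≤0⇒n≡0 (Graded-deg g))
Graded→E⁺ (suc k) φ g with Graded-split g
... | inj₁ lt = inj₂ lt
... | inj₂ dh = inj₁ dh

Graded→U⁺ : ∀ k φ → Graded minus k φ → U⁺ k φ
Graded→U⁺ zero    φ g = inj₁ (n≤0⇒n≡0 (Graded-deg g))
Graded→U⁺ (suc k) φ g with Graded-split g
... | inj₁ lt = inj₂ lt
... | inj₂ dh = inj₁ dh

Graded-∧⁻ : ∀ {a k φ ψ} → Graded a k (φ ∧' ψ) → Graded a k φ × Graded a k ψ
Graded-∧⁻ {φ = φ} (graded g) = graded (++⁻ˡ (Alt φ) g) , graded (++⁻ʳ (Alt φ) g)

Graded-∨⁻ : ∀ {a k φ ψ} → Graded a k (φ ∨' ψ) → Graded a k φ × Graded a k ψ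
Graded-∨⁻ {φ = φ} (graded g) = graded (++⁻ˡ (Alt φ) g) , graded (++⁻ʳ (Alt φ) g)

Graded-∨⁺ : ∀ {a k φ ψ} → Graded a k φ → Graded a k ψ → Graded a k (φ ∨' ψ)
Graded-∨⁺ (graded g) (graded h) = graded (++⁺ g h)

flip-involutive : ∀ a → flip (flip a) ≡ a
flip-involutive plus  = refl
flip-involutive minus = refl

Admissible-perp⁺ : ∀ {a k} s → Admissible a k s → Admissible (flip a) k (perp s)
Admissible-perp⁺ {a} {k} s (p , q) =
  transport (_≤ k) (sym (length-map flip s)) p , (λ e → startsWith-perp s (q (trans (sym (length-map flip s)) e)))
  where startsWith-perp : ∀ s → StartsWith a s → StartsWith (flip a) (perp s)
        startsWith-perp []      _    = tt
        startsWith-perp (b ∷ s) refl = refl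

Admissible-perp⁻ : ∀ {a k} s → Admissible a k (perp s) → Admissible (flip a) k s
Admissible-perp⁻ {a} {k} s (p , q) =
  transport (_≤ k) (length-map flip s) p , (λ e → startsWith-perp s (q (trans (length-map flip s) e)))
  where startsWith-perp : ∀ s → StartsWith a (perp s) → StartsWith (flip a) s
        startsWith-perp []      _ = tt
        startsWith-perp (b ∷ s) e = trans (sym (flip-involutive b)) (cong flip e)

Graded-⇒⁻ : ∀ {a k φ ψ} → Graded a k (φ ⇒ ψ) → Graded (flip a) k φ × Graded a k ψ
Graded-⇒⁻ {φ = φ} (graded g) =
  graded (All.map (λ {s} → Admissible-perp⁻ s) (map⁻ (++⁻ˡ (map perp (Alt φ)) g))) , graded (++⁻ʳ (map perp (Alt φ)) g)

Graded-⇒⁺ : ∀ {a k φ ψ} → Graded (flip a) k φ → Graded a k ψ → Graded a k (φ ⇒ ψ)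
Graded-⇒⁺ {a} {k} (graded g) (graded h) =
  graded (++⁺ (map⁺ (All.map (λ {s} o → transport (λ b → Admissible b k (perp s)) (flip-involutive a) (Admissible-perp⁺ s o)) g)) h)

Admissible-consUnless⁻ : ∀ a {k} s → Admissible a k (consUnless a s) → Admissible a k s
Admissible-consUnless⁻ plus  []          _       = z≤n , (λ _ → tt)
Admissible-consUnless⁻ minus []          _       = z≤n , (λ _ → tt)
Admissible-consUnless⁻ plus  (plus ∷ s)  o       = o
Admissible-consUnless⁻ plus  (minus ∷ s) (p , _) = ≤-trans (n≤1+n _) p , (λ e → ⊥-elim (<-irrefl e p))
Admissible-consUnless⁻ minus (minus ∷ s) o       = o
Admissible-consUnless⁻ minus (plus ∷ s)  (p , _) = ≤-trans (n≤1+n _) p , (λ e → ⊥-elim (<-irrefl e p))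

Admissible-consUnless⁺ : ∀ a {k} s → 1 ≤ k → Admissible a k s → Admissible a k (consUnless a s)
Admissible-consUnless⁺ plus  []          1≤k _ = 1≤k , (λ _ → refl)
Admissible-consUnless⁺ minus []          1≤k _ = 1≤k , (λ _ → refl)
Admissible-consUnless⁺ plus  (plus ∷ s)  _   o = o
Admissible-consUnless⁺ minus (minus ∷ s) _   o = o
Admissible-consUnless⁺ plus  (minus ∷ s) _   (p , q) with m≤n⇒m<n∨m≡n p
... | inj₁ lt = lt , (λ _ → refl)
... | inj₂ e with q e
... | ()
Admissible-consUnless⁺ minus (plus ∷ s)  _   (p , q) with m≤n⇒m<n∨m≡n p
... | inj₁ lt = lt , (λ _ → refl)
... | inj₂ e with q e
... | ()

Graded-∀⁻ : ∀ {k φ} → Graded minus k (∀' φ) → Graded minus k φ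
Graded-∀⁻ (graded g) = graded (All.map (λ {s} → Admissible-consUnless⁻ minus s) (map⁻ g))

Graded-∃⁻ : ∀ {k φ} → Graded plus k (∃' φ) → Graded plus k φ
Graded-∃⁻ (graded g) = graded (All.map (λ {s} → Admissible-consUnless⁻ plus s) (map⁻ g))

Graded-∀⁺ : ∀ {k φ} → 1 ≤ k → Graded minus k φ → Graded minus k (∀' φ)
Graded-∀⁺ 1≤k (graded g) = graded (map⁺ (All.map (λ {s} → Admissible-consUnless⁺ minus s 1≤k) g))

Graded-∃⁺ : ∀ {k φ} → 1 ≤ k → Graded plus k φ → Graded plus k (∃' φ)
Graded-∃⁺ 1≤k (graded g) = graded (map⁺ (All.map (λ {s} → Admissible-consUnless⁺ plus s 1≤k) g))

Graded-suc : ∀ {a b k φ} → Graded a k φ → Graded b (suc k) φ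
Graded-suc (graded g) = graded (All.map (λ (p , q) → ≤-trans p (n≤1+n _) , (λ e → ⊥-elim (<-irrefl e (s≤s p)))) g)

consUnless-head : ∀ a s → Σ[ r ∈ List Sign ] consUnless a s ≡ a ∷ r
consUnless-head plus  []          = _ , refl
consUnless-head minus []          = _ , refl
consUnless-head plus  (plus ∷ s)  = _ , refl
consUnless-head plus  (minus ∷ s) = _ , refl
consUnless-head minus (minus ∷ s) = _ , refl
consUnless-head minus (plus ∷ s)  = _ , refl

Alt-nonempty : ∀ φ → Σ[ s ∈ List Sign ] s ∈ Alt φ
Alt-nonempty (t ≐ s)  = [] , here refl
Alt-nonempty ⊥'       = [] , here refl
Alt-nonempty (φ ⇒ ψ)  with Alt-nonempty φ
... | s , m = perp s , ∈-++⁺ˡ (∈-map⁺ perp m)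
Alt-nonempty (φ ∧' ψ) with Alt-nonempty φ
... | s , m = s , ∈-++⁺ˡ m
Alt-nonempty (φ ∨' ψ) with Alt-nonempty φ
... | s , m = s , ∈-++⁺ˡ m
Alt-nonempty (∀' φ)   with Alt-nonempty φ
... | s , m = consUnless minus s , ∈-map⁺ (consUnless minus) m
Alt-nonempty (∃' φ)   with Alt-nonempty φ
... | s , m = consUnless plus s , ∈-map⁺ (consUnless plus) m

Admissible-nonempty : ∀ {a k b s} → Admissible a k (consUnless b s) → 1 ≤ k
Admissible-nonempty {b = b} {s} (p , _) with consUnless b s | consUnless-head b s
... | _ | _ , refl = ≤-trans (s≤s z≤n) p

Graded-∀-pos : ∀ {a k φ} → Graded a k (∀' φ) → 1 ≤ k
Graded-∀-pos {φ = φ} (graded g) with Alt-nonempty φ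
... | s , m = Admissible-nonempty (All.lookup g (∈-map⁺ (consUnless minus) m))

Graded-∃-pos : ∀ {a k φ} → Graded a k (∃' φ) → 1 ≤ k
Graded-∃-pos {φ = φ} (graded g) with Alt-nonempty φ
... | s , m = Admissible-nonempty (All.lookup g (∈-map⁺ (consUnless plus) m))

Admissible-lower : ∀ {a b k r} → a ≢ b → Admissible a (suc k) (b ∷ r) → Admissible b k (b ∷ r)
Admissible-lower a≢b (p , q) with m≤n⇒m<n∨m≡n p
... | inj₁ lt = ≤-pred lt , (λ _ → refl)
... | inj₂ e  = ⊥-elim (a≢b (sym (q e)))

-- Every alternation path of ∀x φ starts with −, so Graded plus (k+1) forces them all to be shorter
-- than k+1.
Graded-∀-lower : ∀ {k φ} → Graded plus (suc k) (∀' φ) → Graded minus k (∀' φ)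
Graded-∀-lower {φ = φ} (graded g) = graded (All.zipWith lower (startsMinus , g))
  where
  startsMinus : All (λ s → Σ[ r ∈ List Sign ] s ≡ minus ∷ r) (Alt (∀' φ))
  startsMinus = map⁺ (All.tabulate (λ {s} _ → consUnless-head minus s))
  lower : ∀ {k s} → (Σ[ r ∈ List Sign ] s ≡ minus ∷ r) × Admissible plus (suc k) s → Admissible minus k s
  lower ((r , refl) , o) = Admissible-lower {r = r} (λ ()) o

Graded-∃-lower : ∀ {k φ} → Graded minus (suc k) (∃' φ) → Graded plus k (∃' φ)
Graded-∃-lower {φ = φ} (graded g) = graded (All.zipWith lower (startsPlus , g))
  where
  startsPlus : All (λ s → Σ[ r ∈ List Sign ] s ≡ plus ∷ r) (Alt (∃' φ))
  startsPlus = map⁺ (All.tabulate (λ {s} _ → consUnless-head plus s))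
  lower : ∀ {k s} → (Σ[ r ∈ List Sign ] s ≡ plus ∷ r) × Admissible minus (suc k) s → Admissible plus k s
  lower ((r , refl) , o) = Admissible-lower {r = r} (λ ()) o

QF-Alt : ∀ {φ} → QF φ → All (_≡ []) (Alt φ)
QF-Alt qf-eq = refl ∷ []
QF-Alt qf-⊥  = refl ∷ []
QF-Alt (qf-imp p q) = ++⁺ (map⁺ (All.map (λ { refl → refl }) (QF-Alt p))) (QF-Alt q)
QF-Alt (qf-and p q) = ++⁺ (QF-Alt p) (QF-Alt q)
QF-Alt (qf-or p q)  = ++⁺ (QF-Alt p) (QF-Alt q)

QF→Graded : ∀ {a k φ} → QF φ → Graded a k φ
QF→Graded q = graded (All.map (λ { refl → z≤n , (λ _ → tt) }) (QF-Alt q))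

Graded0→QF : ∀ {a} φ → Graded a 0 φ → QF φ
Graded0→QF (t ≐ s)  g = qf-eq
Graded0→QF ⊥'       g = qf-⊥
Graded0→QF (φ ⇒ ψ)  g = let g₁ , g₂ = Graded-⇒⁻ {φ = φ} g in qf-imp (Graded0→QF φ g₁) (Graded0→QF ψ g₂)
Graded0→QF (φ ∧' ψ) g = let g₁ , g₂ = Graded-∧⁻ {φ = φ} g in qf-and (Graded0→QF φ g₁) (Graded0→QF ψ g₂)
Graded0→QF (φ ∨' ψ) g = let g₁ , g₂ = Graded-∨⁻ {φ = φ} g in qf-or (Graded0→QF φ g₁) (Graded0→QF ψ g₂)
Graded0→QF (∀' φ)   g with Graded-∀-pos g
... | ()
Graded0→QF (∃' φ)   g with Graded-∃-pos g
... | ()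

mutual
  Σ→Graded : ∀ {k φ} → SigmaF k φ → Graded plus k φ
  Σ→Graded (σ-qf q)   = QF→Graded q
  Σ→Graded (σ-base p) = Graded-suc (Π→Graded p)
  Σ→Graded (σ-ex s)   = Graded-∃⁺ (s≤s z≤n) (Σ→Graded s)

  Π→Graded : ∀ {k φ} → PiF k φ → Graded minus k φ
  Π→Graded (π-qf q)   = QF→Graded q
  Π→Graded (π-base s) = Graded-suc (Σ→Graded s)
  Π→Graded (π-all p)  = Graded-∀⁺ (s≤s z≤n) (Π→Graded p)

QF-subst : ∀ {φ} σ → QF φ → QF (subst σ φ)
QF-subst σ qf-eq        = qf-eq
QF-subst σ qf-⊥         = qf-⊥
QF-subst σ (qf-imp p q) = qf-imp (QF-subst σ p) (QF-subst σ q)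
QF-subst σ (qf-and p q) = qf-and (QF-subst σ p) (QF-subst σ q)
QF-subst σ (qf-or p q)  = qf-or (QF-subst σ p) (QF-subst σ q)

mutual
  Σ-subst : ∀ {k φ} σ → SigmaF k φ → SigmaF k (subst σ φ)
  Σ-subst σ (σ-qf q)   = σ-qf (QF-subst σ q)
  Σ-subst σ (σ-base p) = σ-base (Π-subst σ p)
  Σ-subst σ (σ-ex s)   = σ-ex (Σ-subst (lift σ) s)

  Π-subst : ∀ {k φ} σ → PiF k φ → PiF k (subst σ φ)
  Π-subst σ (π-qf q)   = π-qf (QF-subst σ q)
  Π-subst σ (π-base s) = π-base (Σ-subst σ s)
  Π-subst σ (π-all p)  = π-all (Π-subst (lift σ) p)

mutual
  QF→Σ : ∀ {k φ} → QF φ → SigmaF k φ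
  QF→Σ {zero}  q = σ-qf q
  QF→Σ {suc k} q = σ-base (QF→Π q)

  QF→Π : ∀ {k φ} → QF φ → PiF k φ
  QF→Π {zero}  q = π-qf q
  QF→Π {suc k} q = π-base (QF→Σ q)

mutual
  Σ-suc : ∀ {k φ} → SigmaF k φ → SigmaF (suc k) φ
  Σ-suc (σ-qf q)   = QF→Σ q
  Σ-suc (σ-base p) = σ-base (Π-suc p)
  Σ-suc (σ-ex s)   = σ-ex (Σ-suc s)

  Π-suc : ∀ {k φ} → PiF k φ → PiF (suc k) φ
  Π-suc (π-qf q)   = QF→Π q
  Π-suc (π-base s) = π-base (Σ-suc s)
  Π-suc (π-all p)  = π-all (Π-suc p)

T₁ : ℕ → Formula → Set
T₁ k = HA+ (DNE (SigmaF k) ∪ DNS (U⁺ k))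

T₂ : ℕ → Formula → Set
T₂ k = HA+ (DNE∨ (PiF k) (PiF k))

FVAmong-DNE : ∀ {n φ} → FVAmong n φ → FVAmong n (¬¬' φ ⇒ φ)
FVAmong-DNE h x (impˡ (impˡ (impˡ f))) = h x f
FVAmong-DNE h x (impʳ f)               = h x f

FVAmong-DNS : ∀ {n φ} → FVAmong (suc n) φ → FVAmong n (∀' (¬¬' φ) ⇒ ¬¬' (∀' φ))
FVAmong-DNS h x (impˡ (all (impˡ (impˡ f)))) = ≤-pred (h (suc x) f)
FVAmong-DNS h x (impʳ (impˡ (impˡ (all f)))) = ≤-pred (h (suc x) f)

FVAmong-∨ˡ : ∀ {n φ ψ} → FVAmong n (φ ∨' ψ) → FVAmong n φ
FVAmong-∨ˡ h x f = h x (orˡ f)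

FVAmong-∨ʳ : ∀ {n φ ψ} → FVAmong n (φ ∨' ψ) → FVAmong n ψ
FVAmong-∨ʳ h x f = h x (orʳ f)

Σ-stable : ∀ {k σ} → SigmaF k σ → Stable (T₁ k) σ
Σ-stable {σ = σ} s =
  ∀^-elim (fvBound σ) (FVAmong-DNE (fvBound-sound σ)) (ax (inj₂ (inj₁ (dne (fvBound σ) σ s (fvBound-sound σ)))))

U⁺-DNShift : ∀ {k φ} → U⁺ k φ → DNShift (T₁ k) φ
U⁺-DNShift {φ = φ} u = ∀^-elim (fvBound φ) (FVAmong-DNS fv) (ax (inj₂ (inj₂ (dns (fvBound φ) φ u fv))))
  where fv : FVAmong (suc (fvBound φ)) φ
        fv x f = ≤-trans (fvBound-sound φ x f) (n≤1+n _)

Π∨Π-stable : ∀ {k φ ψ} → PiF k φ → PiF k ψ → Stable (T₂ k) (φ ∨' ψ)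
Π∨Π-stable {φ = φ} {ψ} p q =
  ∀^-elim n (FVAmong-DNE (fvBound-sound (φ ∨' ψ)))
    (ax (inj₂ (dne∨ n φ ψ p q (FVAmong-∨ˡ (fvBound-sound (φ ∨' ψ))) (FVAmong-∨ʳ (fvBound-sound (φ ∨' ψ))))))
  where n = fvBound (φ ∨' ψ)

Π-stable : ∀ {k π} → PiF k π → Stable (T₂ k) π
Π-stable {k} p = ⇒-trans (¬¬-mono (⇒I (∨I₁ #0))) (⇒-trans (Π∨Π-stable p (QF→Π {k} qf-⊥)) (⇒I (∨E #0 #0 (⊥E #0))))

-- The view v is either id or ¬¬'.
record Prenex (T : Formula → Set) (C : ℕ → Formula → Set) (k : ℕ) (v : Formula → Formula) (φ : Formula) : Set where
  constructor prenex
  field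
    nf       : Formula
    nf-class : C k nf
    nf-fv    : SameFV φ nf
    nf-equiv : T ⊢ (v φ ⇔ v nf)
open Prenex

module _ {T : Formula → Set} {C : ℕ → Formula → Set} {k : ℕ} {v : Formula → Formula} where

  Prenex-self : ∀ {φ} → C k φ → Prenex T C k v φ
  Prenex-self c = prenex _ c SameFV-refl ⇔-refl

  via : ∀ {φ ψ} → SameFV φ ψ → T ⊢ (v φ ⇔ v ψ) → Prenex T C k v ψ → Prenex T C k v φ
  via e d (prenex χ c f q) = prenex χ c (SameFV-trans e f) (⇔-trans d q)

  Prenex-interpret : ∀ {T' φ} → Interprets T T' → Prenex T C k v φ → Prenex T' C k v φ
  Prenex-interpret i (prenex χ c f e) = prenex χ c f (interpret i e)

  Prenex-class : ∀ {C' k' φ} → (∀ {χ} → C k χ → C' k' χ) → Prenex T C k v φ → Prenex T C' k' v φ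
  Prenex-class i (prenex χ c f e) = prenex χ (i c) f e

module _ {T : Formula → Set} {C : ℕ → Formula → Set} {k : ℕ} where

  Prenex-¬¬ : ∀ {φ} → Prenex T C k id φ → Prenex T C k ¬¬' φ
  Prenex-¬¬ (prenex χ c f e) = prenex χ c f (¬¬-cong e)

module _ {T : Formula → Set} {k : ℕ} where

  Prenex-∃ : ∀ {φ} → Prenex T SigmaF (suc k) id φ → Prenex T SigmaF (suc k) id (∃' φ)
  Prenex-∃ (prenex χ c f e) = prenex (∃' χ) (σ-ex c) (SameFV-quant existential f) (∃-cong e)

  Prenex-∃¬¬ : ∀ {φ} → Prenex T SigmaF (suc k) ¬¬' φ → Prenex T SigmaF (suc k) ¬¬' (∃' φ)
  Prenex-∃¬¬ (prenex χ c f e) = prenex (∃' χ) (σ-ex c) (SameFV-quant existential f) (¬¬-∃-cong e)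

  Prenex-∀ : ∀ {φ} → Prenex T PiF (suc k) id φ → Prenex T PiF (suc k) id (∀' φ)
  Prenex-∀ (prenex χ c f e) = prenex (∀' χ) (π-all c) (SameFV-quant universal f) (∀-cong e)

  Prenex-∀¬¬ : ∀ {φ} → DNShift T φ → (∀ {χ} → PiF (suc k) χ → DNShift T χ) →
               Prenex T PiF (suc k) ¬¬' φ → Prenex T PiF (suc k) ¬¬' (∀' φ)
  Prenex-∀¬¬ shiftφ shiftΠ (prenex χ c f e) =
    prenex (∀' χ) (π-all c) (SameFV-quant universal f) (¬¬-∀-cong shiftφ (shiftΠ c) e)

module _ {T : Formula → Set} where

  mutual
    ∧-Σ : ∀ {k φ ψ} → SigmaF k φ → SigmaF k ψ → Prenex T SigmaF k id (φ ∧' ψ)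
    ∧-Σ (σ-qf p) (σ-qf q) = Prenex-self (σ-qf (qf-and p q))
    ∧-Σ {φ = ∃' φ} {ψ} (σ-ex s) t =
      via (SameFV-pullˡ and existential existential φ ψ) (∃-∧ˡ φ ψ) (Prenex-∃ (∧-Σ s (Σ-subst ↑ t)))
    ∧-Σ (σ-base p) t = ∧-ΠΣ p t

    ∧-ΠΣ : ∀ {k φ ψ} → PiF k φ → SigmaF (suc k) ψ → Prenex T SigmaF (suc k) id (φ ∧' ψ)
    ∧-ΠΣ {φ = φ} {∃' ψ} p (σ-ex t) =
      via (SameFV-pullʳ and existential existential ψ φ) (∃-∧ʳ ψ φ) (Prenex-∃ (∧-ΠΣ (Π-subst ↑ p) t))
    ∧-ΠΣ p (σ-base q) = Prenex-class σ-base (∧-Π p q)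

    ∧-Π : ∀ {k φ ψ} → PiF k φ → PiF k ψ → Prenex T PiF k id (φ ∧' ψ)
    ∧-Π (π-qf p) (π-qf q) = Prenex-self (π-qf (qf-and p q))
    ∧-Π {φ = ∀' φ} {ψ} (π-all p) q =
      via (SameFV-pullˡ and universal universal φ ψ) (∀-∧ˡ φ ψ) (Prenex-∀ (∧-Π p (Π-subst ↑ q)))
    ∧-Π (π-base s) q = ∧-ΣΠ s q

    ∧-ΣΠ : ∀ {k φ ψ} → SigmaF k φ → PiF (suc k) ψ → Prenex T PiF (suc k) id (φ ∧' ψ)
    ∧-ΣΠ {φ = φ} {∀' ψ} s (π-all q) =
      via (SameFV-pullʳ and universal universal ψ φ) (∀-∧ʳ ψ φ) (Prenex-∀ (∧-ΣΠ (Σ-subst ↑ s) q))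
    ∧-ΣΠ s (π-base t) = Prenex-class π-base (∧-Σ s t)

data Guard : Formula → Set where
  zero?    : ∀ i → Guard (isZero i)
  nonzero? : ∀ i → Guard (¬' (isZero i))

Guard-shift : ∀ {δ} → Guard δ → Guard (shift δ)
Guard-shift (zero? i)    = zero? (suc i)
Guard-shift (nonzero? i) = nonzero? (suc i)

Guard-QF : ∀ {δ} → Guard δ → QF δ
Guard-QF (zero? i)    = qf-eq
Guard-QF (nonzero? i) = qf-imp qf-eq qf-⊥

module _ {T : Formula → Set} (hax : ∀ {φ} → HAAx φ → T φ) where

  Guard-decidable : ∀ {δ} → Guard δ → T ⊢ (δ ∨' ¬' δ)
  Guard-decidable (zero? i)    = isZero-decidable hax i
  Guard-decidable (nonzero? i) = ∨E (isZero-decidable hax i) (∨I₂ (apply ¬¬-intro #0)) (∨I₁ #0)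

  Guarded : (ℕ → Formula → Set) → ℕ → Formula → Formula → Set
  Guarded C k δ φ = Σ[ ψ ∈ Formula ] C k ψ × T ⊢ ((δ ⇒ φ) ⇔ ψ)

  -- Decidability of the guard is what lets δ ⇒ ∃x φ become ∃x (δ ⇒ φ).
  mutual
    guard-Σ : ∀ {k δ φ} → Guard δ → SigmaF k φ → Guarded SigmaF k δ φ
    guard-Σ g (σ-qf q) = _ , σ-qf (qf-imp (Guard-QF g) q) , ⇔-refl
    guard-Σ g (σ-ex {φ = φ} s) with guard-Σ (Guard-shift g) s
    ... | ψ , s' , e = ∃' ψ , σ-ex s' , ⇔-trans (∃-⇒ʳ-decidable φ (Guard-decidable g)) (∃-cong e)
    guard-Σ g (σ-base p) with guard-Π g p
    ... | ψ , p' , e = ψ , σ-base p' , e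

    guard-Π : ∀ {k δ φ} → Guard δ → PiF k φ → Guarded PiF k δ φ
    guard-Π g (π-qf q) = _ , π-qf (qf-imp (Guard-QF g) q) , ⇔-refl
    guard-Π {δ = δ} g (π-all {φ = φ} p) with guard-Π (Guard-shift g) p
    ... | ψ , p' , e = ∀' ψ , π-all p' , ⇔-trans (∀-⇒ʳ φ δ) (∀-cong e)
    guard-Π g (π-base s) with guard-Σ g s
    ... | ψ , s' , e = ψ , π-base s' , e

  Π∨Π-as-Σ : ∀ {k φ ψ} → PiF k φ → PiF k ψ → Σ[ χ ∈ Formula ] SigmaF (suc k) χ × T ⊢ (φ ∨' ψ ⇔ χ)
  Π∨Π-as-Σ {φ = φ} {ψ} p q with guard-Π (zero? 0) (Π-subst ↑ p) | guard-Π (nonzero? 0) (Π-subst ↑ q)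
  ... | _ , p' , e | _ , q' , f with ∧-Π {T = T} p' q'
  ... | prenex χ c _ g = ∃' χ , σ-ex (σ-base c) , ⇔-trans (∨-as-∃ hax φ ψ) (∃-cong (⇔-trans (∧-cong e f) g))

record Normalisation (k : ℕ) : Set where
  field
    Σ-normal : ∀ {φ} → Graded plus k φ → Prenex (T₁ k) SigmaF k id φ
    Π-normal : ∀ {φ} → Graded minus k φ → Prenex (T₂ k) PiF k id φ
open Normalisation

module _ {k : ℕ} where

  U⁺-suc : ∀ {φ} → U⁺ k φ → U⁺ (suc k) φ
  U⁺-suc {φ} u = Graded→U⁺ (suc k) φ (Graded-suc (U⁺→Graded k φ u))

  T₁-mono : Interprets (T₁ k) (T₁ (suc k))
  T₁-mono (inj₁ h)                     = ax (inj₁ h)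
  T₁-mono (inj₂ (inj₁ (dne n φ s fv))) = ax (inj₂ (inj₁ (dne n φ (Σ-suc s) fv)))
  T₁-mono (inj₂ (inj₂ (dns n φ u fv))) = ax (inj₂ (inj₂ (dns n φ (U⁺-suc u) fv)))

  T₂-mono : Interprets (T₂ k) (T₂ (suc k))
  T₂-mono (inj₁ h)                          = ax (inj₁ h)
  T₂-mono (inj₂ (dne∨ n φ ψ p q fvφ fvψ)) = ax (inj₂ (dne∨ n φ ψ (Π-suc p) (Π-suc q) fvφ fvψ))

  T₂→T₁ : Interprets (T₂ k) (T₁ (suc k))
  T₂→T₁ (inj₁ h) = ax (inj₁ h)
  T₂→T₁ (inj₂ (dne∨ n φ ψ p q _ _)) with Π∨Π-as-Σ inj₁ p q
  ... | _ , s , e = ∀^-intro n (Stable-⇔ e (Σ-stable s))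

  -- A DNS instance at level k is derivable once its U⁺_k formula is equivalent to a stable Π_k one.
  T₁→T₂ : (∀ {φ} → Graded minus k φ → Prenex (T₂ k) PiF k id φ) → Interprets (T₁ k) (T₂ (suc k))
  T₁→T₂ Π-normal (inj₁ h) = ax (inj₁ h)
  T₁→T₂ Π-normal (inj₂ (inj₁ (dne n _ s _))) = ∀^-intro n (Π-stable (π-base s))
  T₁→T₂ Π-normal (inj₂ (inj₂ (dns n φ u _))) =
    ∀^-intro n (Stable→DNShift (Stable-⇔ (interpret T₂-mono (nf-equiv r)) (Π-stable (Π-suc (nf-class r)))))
    where r = Π-normal (U⁺→Graded k φ u)

module Step {k : ℕ} (IH : Normalisation k) where

  K : ℕ
  K = suc k

  Graded-DNShift : ∀ {φ} → Graded minus K φ → DNShift (T₁ K) φ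
  Graded-DNShift {φ} g = U⁺-DNShift (Graded→U⁺ K φ g)

  Π-DNShift : ∀ {φ} → PiF K φ → DNShift (T₁ K) φ
  Π-DNShift p = Graded-DNShift (Π→Graded p)

  Prenex-stable : ∀ {φ} → Prenex (T₁ K) SigmaF K id φ → Stable (T₁ K) φ
  Prenex-stable r = Stable-⇔ (nf-equiv r) (Σ-stable (nf-class r))

  IH-as-Σ : ∀ {T φ} → Interprets (T₂ k) T → Graded minus k φ → Prenex T SigmaF K id φ
  IH-as-Σ i g = Prenex-class σ-base (Prenex-interpret i (Π-normal IH g))

  IH-as-Π : ∀ {T φ} → Interprets (T₁ k) T → Graded plus k φ → Prenex T PiF K id φ
  IH-as-Π i g = Prenex-class π-base (Prenex-interpret i (Σ-normal IH g))

  module _ {T : Formula → Set} (i : Interprets (T₂ k) T) where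
    mutual
      ∨-Σ : ∀ {φ ψ} → SigmaF K φ → SigmaF K ψ → Prenex T SigmaF K id (φ ∨' ψ)
      ∨-Σ {∃' φ} {ψ} (σ-ex s) t =
        via (SameFV-pullˡ or existential existential φ ψ) (∃-∨ˡ φ ψ) (Prenex-∃ (∨-Σ s (Σ-subst ↑ t)))
      ∨-Σ (σ-base p) t = ∨-ΠΣ p t

      ∨-ΠΣ : ∀ {φ ψ} → PiF k φ → SigmaF K ψ → Prenex T SigmaF K id (φ ∨' ψ)
      ∨-ΠΣ {φ} {∃' ψ} p (σ-ex t) =
        via (SameFV-pullʳ or existential existential ψ φ) (∃-∨ʳ ψ φ) (Prenex-∃ (∨-ΠΣ (Π-subst ↑ p) t))
      ∨-ΠΣ p (σ-base q) = IH-as-Σ i (Graded-∨⁺ (Π→Graded p) (Π→Graded q))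

  mutual
    ∨-Π : ∀ {φ ψ} → PiF K φ → PiF K ψ → Prenex (T₂ K) PiF K id (φ ∨' ψ)
    ∨-Π {∀' φ} {ψ} (π-all p) q =
      via (SameFV-pullˡ or universal universal φ ψ) (∀-∨ˡ-stable φ ψ (Π∨Π-stable (π-all p) q))
          (Prenex-∀ (∨-Π p (Π-subst ↑ q)))
    ∨-Π (π-base s) q = ∨-ΣΠ s q

    ∨-ΣΠ : ∀ {φ ψ} → SigmaF k φ → PiF K ψ → Prenex (T₂ K) PiF K id (φ ∨' ψ)
    ∨-ΣΠ {φ} {∀' ψ} s (π-all q) =
      via (SameFV-pullʳ or universal universal ψ φ) (∀-∨ʳ-stable ψ φ (Π∨Π-stable (π-base s) (π-all q)))
          (Prenex-∀ (∨-ΣΠ (Σ-subst ↑ s) q))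
    ∨-ΣΠ s (π-base t) = IH-as-Π (T₁→T₂ (Π-normal IH)) (Graded-∨⁺ (Σ→Graded s) (Σ→Graded t))

  mutual
    ∨-Π¬¬ : ∀ {φ ψ} → PiF K φ → PiF K ψ → Prenex (T₁ K) PiF K ¬¬' (φ ∨' ψ)
    ∨-Π¬¬ {∀' φ} {ψ} (π-all p) q =
      via (SameFV-pullˡ or universal universal φ ψ) (¬¬-∀-∨ˡ φ ψ)
          (Prenex-∀¬¬ (Graded-DNShift (Graded-∨⁺ (Π→Graded p) (Π→Graded q′))) Π-DNShift (∨-Π¬¬ p q′))
      where q′ = Π-subst ↑ q
    ∨-Π¬¬ (π-base s) q = ∨-ΣΠ¬¬ s q

    ∨-ΣΠ¬¬ : ∀ {φ ψ} → SigmaF k φ → PiF K ψ → Prenex (T₁ K) PiF K ¬¬' (φ ∨' ψ)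
    ∨-ΣΠ¬¬ {φ} {∀' ψ} s (π-all q) =
      via (SameFV-pullʳ or universal universal ψ φ) (¬¬-∀-∨ʳ ψ φ)
          (Prenex-∀¬¬ (Graded-DNShift (Graded-∨⁺ (Π→Graded (π-base s′)) (Π→Graded q))) Π-DNShift (∨-ΣΠ¬¬ s′ q))
      where s′ = Σ-subst ↑ s
    ∨-ΣΠ¬¬ s (π-base t) = Prenex-¬¬ (IH-as-Π T₁-mono (Graded-∨⁺ (Σ→Graded s) (Σ→Graded t)))

  module _ {T : Formula → Set} (i : Interprets (T₁ k) T) where
    mutual
      ⇒-ΣΠ : ∀ {φ ψ} → SigmaF K φ → PiF K ψ → Prenex T PiF K id (φ ⇒ ψ)
      ⇒-ΣΠ {∃' φ} {ψ} (σ-ex s) p =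
        via (SameFV-pullˡ imp existential universal φ ψ) (∃-⇒ˡ φ ψ) (Prenex-∀ (⇒-ΣΠ s (Π-subst ↑ p)))
      ⇒-ΣΠ (σ-base q) p = ⇒-ΠΠ q p

      ⇒-ΠΠ : ∀ {φ ψ} → PiF k φ → PiF K ψ → Prenex T PiF K id (φ ⇒ ψ)
      ⇒-ΠΠ {φ} {∀' ψ} q (π-all p) =
        via (SameFV-pullʳ imp universal universal ψ φ) (∀-⇒ʳ ψ φ) (Prenex-∀ (⇒-ΠΠ (Π-subst ↑ q) p))
      ⇒-ΠΠ q (π-base s) = IH-as-Π i (Graded-⇒⁺ (Π→Graded q) (Σ→Graded s))

  mutual
    ⇒-ΠΣ : ∀ {φ ψ} → PiF K φ → SigmaF K ψ → Prenex (T₁ K) SigmaF K id (φ ⇒ ψ)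
    ⇒-ΠΣ {∀' φ} {ψ} (π-all p) s =
      via (SameFV-pullˡ imp universal existential φ ψ) (∀-⇒ˡ-stable φ ψ (Π-DNShift p) (Prenex-stable r)) r
      where r = Prenex-∃ (⇒-ΠΣ p (Σ-subst ↑ s))
    ⇒-ΠΣ (π-base t) s = ⇒-ΣΣ t s

    ⇒-ΣΣ : ∀ {φ ψ} → SigmaF k φ → SigmaF K ψ → Prenex (T₁ K) SigmaF K id (φ ⇒ ψ)
    ⇒-ΣΣ {φ} {∃' ψ} t (σ-ex s) =
      via (SameFV-pullʳ imp existential existential ψ φ) (∃-⇒ʳ-stable ψ φ (Prenex-stable r)) r
      where r = Prenex-∃ (⇒-ΣΣ (Σ-subst ↑ t) s)
    ⇒-ΣΣ t (σ-base p) = IH-as-Σ T₂→T₁ (Graded-⇒⁺ (Σ→Graded t) (Π→Graded p))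

  mutual
    ⇒-ΠΣ¬¬ : ∀ {φ ψ} → PiF K φ → SigmaF K ψ → Prenex (T₂ K) SigmaF K ¬¬' (φ ⇒ ψ)
    ⇒-ΠΣ¬¬ {∀' φ} {ψ} (π-all p) s =
      via (SameFV-pullˡ imp universal existential φ ψ) (¬¬-∀-⇒ˡ φ ψ (Stable→DNShift (Π-stable p)))
          (Prenex-∃¬¬ (⇒-ΠΣ¬¬ p (Σ-subst ↑ s)))
    ⇒-ΠΣ¬¬ (π-base t) s = ⇒-ΣΣ¬¬ t s

    ⇒-ΣΣ¬¬ : ∀ {φ ψ} → SigmaF k φ → SigmaF K ψ → Prenex (T₂ K) SigmaF K ¬¬' (φ ⇒ ψ)
    ⇒-ΣΣ¬¬ {φ} {∃' ψ} t (σ-ex s) =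
      via (SameFV-pullʳ imp existential existential ψ φ) (¬¬-∃-⇒ʳ ψ φ) (Prenex-∃¬¬ (⇒-ΣΣ¬¬ (Σ-subst ↑ t) s))
    ⇒-ΣΣ¬¬ t (σ-base p) = Prenex-¬¬ (IH-as-Σ T₂-mono (Graded-⇒⁺ (Σ→Graded t) (Π→Graded p)))

  via₂ : ∀ o {T C C₁ C₂ v v₁ v₂ φ ψ} (r₁ : Prenex T C₁ K v₁ φ) (r₂ : Prenex T C₂ K v₂ ψ) →
         (T ⊢ (v₁ φ ⇔ v₁ (nf r₁)) → T ⊢ (v₂ ψ ⇔ v₂ (nf r₂)) →
          T ⊢ (v (conn o φ ψ) ⇔ v (conn o (nf r₁) (nf r₂)))) →
         (C₁ K (nf r₁) → C₂ K (nf r₂) → Prenex T C K v (conn o (nf r₁) (nf r₂))) →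
         Prenex T C K v (conn o φ ψ)
  via₂ o r₁ r₂ cong combine =
    via (SameFV-conn o (nf-fv r₁) (nf-fv r₂)) (cong (nf-equiv r₁) (nf-equiv r₂)) (combine (nf-class r₁) (nf-class r₂))

  record Normalisable (φ : Formula) : Set where
    field
      Σ₁   : Graded plus K φ  → Prenex (T₁ K) SigmaF K id φ
      Π¬¬₁ : Graded minus K φ → Prenex (T₁ K) PiF K ¬¬' φ
      Π₂   : Graded minus K φ → Prenex (T₂ K) PiF K id φ
      Σ¬¬₂ : Graded plus K φ  → Prenex (T₂ K) SigmaF K ¬¬' φ
  open Normalisable

  normalisable-QF : ∀ {φ} → QF φ → Normalisable φ
  normalisable-QF q = record
    { Σ₁ = λ _ → Prenex-self (QF→Σ q) ; Π¬¬₁ = λ _ → Prenex-self (QF→Π q)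
    ; Π₂ = λ _ → Prenex-self (QF→Π q) ; Σ¬¬₂ = λ _ → Prenex-self (QF→Σ q) }

  normalisable-∧ : ∀ {φ ψ} → Normalisable φ → Normalisable ψ → Normalisable (φ ∧' ψ)
  normalisable-∧ n m = record
    { Σ₁   = λ g → let g₁ , g₂ = Graded-∧⁻ g in
                   via₂ and (Σ₁ n g₁) (Σ₁ m g₂) ∧-cong ∧-Σ
    ; Π¬¬₁ = λ g → let g₁ , g₂ = Graded-∧⁻ g in
                   via₂ and (Π¬¬₁ n g₁) (Π¬¬₁ m g₂) ¬¬-∧-cong (λ p q → Prenex-¬¬ (∧-Π p q))
    ; Π₂   = λ g → let g₁ , g₂ = Graded-∧⁻ g in
                   via₂ and (Π₂ n g₁) (Π₂ m g₂) ∧-cong ∧-Π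
    ; Σ¬¬₂ = λ g → let g₁ , g₂ = Graded-∧⁻ g in
                   via₂ and (Σ¬¬₂ n g₁) (Σ¬¬₂ m g₂) ¬¬-∧-cong (λ s t → Prenex-¬¬ (∧-Σ s t)) }

  normalisable-∨ : ∀ {φ ψ} → Normalisable φ → Normalisable ψ → Normalisable (φ ∨' ψ)
  normalisable-∨ n m = record
    { Σ₁   = λ g → let g₁ , g₂ = Graded-∨⁻ g in
                   via₂ or (Σ₁ n g₁) (Σ₁ m g₂) ∨-cong (∨-Σ T₂→T₁)
    ; Π¬¬₁ = λ g → let g₁ , g₂ = Graded-∨⁻ g in
                   via₂ or (Π¬¬₁ n g₁) (Π¬¬₁ m g₂) ¬¬-∨-cong ∨-Π¬¬
    ; Π₂   = λ g → let g₁ , g₂ = Graded-∨⁻ g in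
                   via₂ or (Π₂ n g₁) (Π₂ m g₂) ∨-cong ∨-Π
    ; Σ¬¬₂ = λ g → let g₁ , g₂ = Graded-∨⁻ g in
                   via₂ or (Σ¬¬₂ n g₁) (Σ¬¬₂ m g₂) ¬¬-∨-cong (λ s t → Prenex-¬¬ (∨-Σ T₂-mono s t)) }

  normalisable-⇒ : ∀ {φ ψ} → Normalisable φ → Normalisable ψ → Normalisable (φ ⇒ ψ)
  normalisable-⇒ n m = record
    { Σ₁   = λ g → let g₁ , g₂ = Graded-⇒⁻ g; r₂ = Σ₁ m g₂ in
                   via₂ imp (Π¬¬₁ n g₁) r₂ (λ e f → ⇒-cong-stable e f (Σ-stable (nf-class r₂))) ⇒-ΠΣ
    ; Π¬¬₁ = λ g → let g₁ , g₂ = Graded-⇒⁻ g in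
                   via₂ imp (Σ₁ n g₁) (Π¬¬₁ m g₂) (λ e f → ¬¬-⇒-cong (¬¬-cong e) f)
                        (λ s p → Prenex-¬¬ (⇒-ΣΠ T₁-mono s p))
    ; Π₂   = λ g → let g₁ , g₂ = Graded-⇒⁻ g; r₂ = Π₂ m g₂ in
                   via₂ imp (Σ¬¬₂ n g₁) r₂ (λ e f → ⇒-cong-stable e f (Π-stable (nf-class r₂)))
                        (⇒-ΣΠ (T₁→T₂ (Π-normal IH)))
    ; Σ¬¬₂ = λ g → let g₁ , g₂ = Graded-⇒⁻ g in
                   via₂ imp (Π₂ n g₁) (Σ¬¬₂ m g₂) (λ e f → ¬¬-⇒-cong (¬¬-cong e) f) ⇒-ΠΣ¬¬ }

  normalisable-∀ : ∀ {φ} → Normalisable φ → Normalisable (∀' φ)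
  normalisable-∀ n = record
    { Σ₁   = λ g → IH-as-Σ T₂→T₁ (Graded-∀-lower g)
    ; Π¬¬₁ = λ g → Prenex-∀¬¬ (Graded-DNShift (Graded-∀⁻ g)) Π-DNShift (Π¬¬₁ n (Graded-∀⁻ g))
    ; Π₂   = λ g → Prenex-∀ (Π₂ n (Graded-∀⁻ g))
    ; Σ¬¬₂ = λ g → Prenex-¬¬ (IH-as-Σ T₂-mono (Graded-∀-lower g)) }

  normalisable-∃ : ∀ {φ} → Normalisable φ → Normalisable (∃' φ)
  normalisable-∃ n = record
    { Σ₁   = λ g → Prenex-∃ (Σ₁ n (Graded-∃⁻ g))
    ; Π¬¬₁ = λ g → Prenex-¬¬ (IH-as-Π T₁-mono (Graded-∃-lower g))
    ; Π₂   = λ g → IH-as-Π (T₁→T₂ (Π-normal IH)) (Graded-∃-lower g)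
    ; Σ¬¬₂ = λ g → Prenex-∃¬¬ (Σ¬¬₂ n (Graded-∃⁻ g)) }

  normalisable : ∀ φ → Normalisable φ
  normalisable (t ≐ s)  = normalisable-QF qf-eq
  normalisable ⊥'       = normalisable-QF qf-⊥
  normalisable (φ ⇒ ψ)  = normalisable-⇒ (normalisable φ) (normalisable ψ)
  normalisable (φ ∧' ψ) = normalisable-∧ (normalisable φ) (normalisable ψ)
  normalisable (φ ∨' ψ) = normalisable-∨ (normalisable φ) (normalisable ψ)
  normalisable (∀' φ)   = normalisable-∀ (normalisable φ)
  normalisable (∃' φ)   = normalisable-∃ (normalisable φ)

  normalisation-suc : Normalisation K
  normalisation-suc = record { Σ-normal = λ {φ} → Σ₁ (normalisable φ) ; Π-normal = λ {φ} → Π₂ (normalisable φ) }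

normalisation : ∀ k → Normalisation k
normalisation zero = record
  { Σ-normal = λ {φ} g → Prenex-self (σ-qf (Graded0→QF φ g))
  ; Π-normal = λ {φ} g → Prenex-self (π-qf (Graded0→QF φ g)) }
normalisation (suc k) = Step.normalisation-suc (normalisation k)

Prenex→Σ : ∀ {T C k φ} → Prenex T C k id φ → Σ[ ψ ∈ Formula ] (C k ψ × SameFV φ ψ × (T ⊢ (φ ⇔' ψ)))
Prenex→Σ (prenex ψ c f e) = ψ , c , f , e

theorem5p3 : (k : ℕ) (φ : Formula) →
    (E⁺ k φ → Σ[ φ' ∈ Formula ] (SigmaF k φ' × SameFV φ φ' × (HA+ (DNE (SigmaF k) ∪ DNS (U⁺ k)) ⊢ (φ ⇔' φ'))))
    × (U⁺ k φ → Σ[ φ' ∈ Formula ] (PiF k φ' × SameFV φ φ' × (HA+ (DNE∨ (PiF k) (PiF k)) ⊢ (φ ⇔' φ'))))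
theorem5p3 k φ = (λ e → Prenex→Σ (Σ-normal (normalisation k) (E⁺→Graded k φ e)))
               , (λ u → Prenex→Σ (Π-normal (normalisation k) (U⁺→Graded k φ u)))
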